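{- Let $b$ be a complex-valued function on graphs with non-empty vertex set and let $f_b(G,x)=\sum_{k=1}^{|V(G)|}a_k(G)x^k$ with $a_k(G)=\sum_{\{S_1,\dots,S_k\}}b(G[S_1])\cdots b(G[S_k])$ summed over partitions of $V(G)$ into exactly $k$ non-empty sets, and $f_b(\emptyset,x)=1$. Then $f_b$ is 2-multiplicative if and only if (i) $b(H)=0$ for every non-connected graph $H$, and (ii) $b(H_1\cup H_2)=b(H_1)b(H_2)$ whenever $H_1$ and $H_2$ are graphs having exactly one vertex in common.
   Context: All graphs are finite simple graphs; $G[S]$ is the induced subgraph on $S$. A graph polynomial $f$ is multiplicative if $f(G_1\uplus G_2,x)=f(G_1,x)f(G_2,x)$ for disjoint unions, and 2-multiplicative if it is multiplicative and $x f(G_1\cup G_2,x)=f(G_1,x)f(G_2,x)$ whenever $G_1$ and $G_2$ have exactly one vertex in common. -}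

module Defs where

open import Level using (Level; _⊔_)
open import Data.Bool using (Bool; true; false; _∧_; _∨_; T)
open import Data.Bool.Properties using (T?)
open import Data.Nat using (ℕ; zero; suc; _<_; _∸_; _≡ᵇ_)
open import Data.List using (List; []; _∷_; [_]; map; concatMap; filter; length; upTo; foldr)
open import Data.Bool.ListAction using (any)
open import Data.Product using (Σ; _×_)
open import Data.Empty using (⊥)
open import Relation.Binary.PropositionalEquality using (_≡_; refl)
open import Algebra.Bundles using (CommutativeRing)
import Data.Nat as ℕ

-- Two records describe the same graph iff they are related by _≈ᴳ_.

record Graph : Set where
  field
    V       : ℕ → Bool
    bound   : ℕ
    bounded : ∀ v → V v ≡ true → v < bound
    E       : ℕ → ℕ → Bool
    sym     : ∀ u v → E u v ≡ E v u
    irr     : ∀ v → E v v ≡ false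

open Graph public

verts : Graph → List ℕ
verts G = filter (λ v → T? (V G v)) (upTo (bound G))

_≈ᴳ_ : Graph → Graph → Set
G ≈ᴳ H = (∀ v → V G v ≡ V H v)
       × (∀ u v → V G u ≡ true → V G v ≡ true → E G u v ≡ E H u v)

_∈ᵇ_ : ℕ → List ℕ → Bool
v ∈ᵇ S = any (λ w → v ≡ᵇ w) S

∧-true-left : ∀ (a c : Bool) → a ∧ c ≡ true → a ≡ true
∧-true-left true  c p = refl
∧-true-left false c ()

induced : Graph → List ℕ → Graph
induced G S = record
  { V       = λ v → V G v ∧ (v ∈ᵇ S)
  ; bound   = bound G
  ; bounded = λ v p → bounded G v (∧-true-left (V G v) (v ∈ᵇ S) p)
  ; E       = E G
  ; sym     = sym G
  ; irr     = irr G
  }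

NonEmpty : Graph → Set
NonEmpty G = Σ ℕ λ v → V G v ≡ true

data Walk (G : Graph) : ℕ → ℕ → Set where
  here : ∀ {u} → Walk G u u
  step : ∀ {u w v} → E G u w ≡ true → V G w ≡ true → Walk G w v → Walk G u v

Connected : Graph → Set
Connected G = ∀ u v → V G u ≡ true → V G v ≡ true → Walk G u v

IsUnion : Graph → Graph → Graph → Set
IsUnion G G₁ G₂ =
    (∀ v → V G v ≡ (V G₁ v ∨ V G₂ v))
  × (∀ u v → V G u ≡ true → V G v ≡ true →
       E G u v ≡ ((V G₁ u ∧ V G₁ v ∧ E G₁ u v) ∨ (V G₂ u ∧ V G₂ v ∧ E G₂ u v)))

Disjoint : Graph → Graph → Set
Disjoint G₁ G₂ = ∀ v → V G₁ v ≡ true → V G₂ v ≡ true → ⊥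

OneCommon : Graph → Graph → Set
OneCommon G₁ G₂ = Σ ℕ λ w → V G₁ w ≡ true × V G₂ w ≡ true
                  × (∀ u → V G₁ u ≡ true → V G₂ u ≡ true → u ≡ w)

-- Set partitions of a list of distinct elements into non-empty blocks;
-- each unordered partition is produced exactly once.

insertEach : ℕ → List (List ℕ) → List (List (List ℕ))
insertEach v []      = []
insertEach v (B ∷ P) = ((v ∷ B) ∷ P) ∷ map (B ∷_) (insertEach v P)

partitions : List ℕ → List (List (List ℕ))
partitions []       = [ [] ]
partitions (v ∷ vs) = concatMap (λ P → ([ v ] ∷ P) ∷ insertEach v P) (partitions vs)

module Poly {c ℓ : Level} (R : CommutativeRing c ℓ) where
  open CommutativeRing R

  Σᴿ : List Carrier → Carrier
  Σᴿ = foldr _+_ 0#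

  Πᴿ : List Carrier → Carrier
  Πᴿ = foldr _*_ 1#

  coeff : (Graph → Carrier) → Graph → ℕ → Carrier
  coeff b G k =
    Σᴿ (map (λ P → Πᴿ (map (λ S → b (induced G S)) P))
            (filter (λ P → length P ℕ.≟ k) (partitions (verts G))))

  conv : (ℕ → Carrier) → (ℕ → Carrier) → ℕ → Carrier
  conv p q k = Σᴿ (map (λ i → p i * q (k ∸ i)) (upTo (suc k)))

  -- coefficients of x · p
  shift : (ℕ → Carrier) → ℕ → Carrier
  shift p zero    = 0#
  shift p (suc k) = p k

  RespectsG : (Graph → Carrier) → Set ℓ
  RespectsG b = ∀ G H → G ≈ᴳ H → b G ≈ b H

  Multiplicative : (Graph → Carrier) → Set ℓ
  Multiplicative b = ∀ G G₁ G₂ → IsUnion G G₁ G₂ → Disjoint G₁ G₂ →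
    ∀ k → coeff b G k ≈ conv (coeff b G₁) (coeff b G₂) k

  TwoMultiplicative : (Graph → Carrier) → Set ℓ
  TwoMultiplicative b = Multiplicative b
    × (∀ G G₁ G₂ → IsUnion G G₁ G₂ → OneCommon G₁ G₂ →
         ∀ k → shift (coeff b G) k ≈ conv (coeff b G₁) (coeff b G₂) k)

module Submission where

-- The coefficient a_k(G) is the partition sum  Z w L k = Σ_P Π_{B ∈ P} w B
-- over the partitions P of the vertex list L of G into k blocks, with
-- weight w B = b (G[B]).  The only fact used about Z is its head-block
-- recursion  Z w [] = 1,  Z w (v ∷ vs) = x · Σ_{T ⊆ vs} w (v ∷ T) · Z w (vs \ T);
-- from it, by induction on the degree, Z is invariant under permuting L,
-- multiplicative along a two-colouring of L when w vanishes on mixed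
-- blocks, and satisfies a gluing identity at one shared entry c when the
-- weights w (c ∷ T) factor over the colours of T.  Graph lemmas then show
-- that under (i) mixed blocks of a union induce disconnected graphs, and
-- that (ii) factors the blocks through the common vertex; this proves
-- (i) ∧ (ii) ⇒ 2-multiplicative.  Conversely, the coefficients of x and x²
-- in the (2-)multiplicativity identities give (i) and (ii).

open import Level using (Level)
open import Function using (_∘_)
open import Function.Bundles using (_⇔_; mk⇔; Equivalence)
open import Data.Bool using (Bool; true; false; _∧_; _∨_; not; if_then_else_)
open import Data.Bool.Properties using (T-≡; not-involutive; ∨-assoc; ∨-comm; ∨-zeroʳ; ∨-identityʳ; ∧-zeroʳ; ∧-idem)
open import Data.Bool.ListAction using (all; and; any)
open import Data.Nat using (ℕ; zero; suc; _≤_; _<_; _≡ᵇ_; _∸_; z≤n; s≤s)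
open import Data.Nat.Properties using (≡ᵇ⇒≡; ≡⇒≡ᵇ; ≤-trans; ≤-total; ≤-pred; <-irrefl; m≤n⇒m≤1+n; ≤-reflexive; m<1+n⇒m<n∨m≡n; m≤n⇒m<n∨m≡n)
open import Data.Product using (Σ; _×_; _,_; proj₁; proj₂; uncurry)
open import Data.Sum using (_⊎_; inj₁; inj₂)
open import Data.Empty using (⊥-elim)
open import Data.List using (List; []; _∷_; [_]; _++_; map; concatMap; filter; filterᵇ; length; upTo; applyUpTo)
open import Data.List.Properties using (length-filter; map-cong; map-upTo; upTo-∷ʳ; length-upTo; ++-identityʳ; filter-++)
open import Data.List.Relation.Unary.All using (All; []; _∷_)
import Data.List.Relation.Unary.All as All
open import Data.List.Relation.Unary.All.Properties using (++⁺; ++⁻ˡ; ++⁻ʳ; map⁺)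
open import Data.List.Relation.Unary.Unique.Propositional using (Unique)
open import Data.List.Relation.Unary.Unique.Propositional.Properties using (upTo⁺; filter⁺)
open import Data.List.Relation.Unary.AllPairs.Core using ([]; _∷_)
open import Data.List.Relation.Binary.Permutation.Propositional as Perm using (_↭_)
open import Data.List.Relation.Binary.Permutation.Propositional.Properties using () renaming (shift to ↭-shift)
open import Relation.Binary.PropositionalEquality as Eq using (_≡_; refl; cong; cong₂; subst; subst₂)
open import Relation.Nullary using (¬_)
open import Relation.Nullary.Decidable.Core using (T?)
open import Algebra.Bundles using (CommutativeRing; CommutativeMonoid)
import Algebra.Properties.CommutativeSemigroup as CommSemigroupProperties
open import Defs
import Data.Nat as ℕ

≡ᵇ-refl : ∀ n → (n ≡ᵇ n) ≡ true
≡ᵇ-refl n = Equivalence.to T-≡ (≡⇒≡ᵇ n n refl)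

≡ᵇ-true⇒≡ : ∀ m n → (m ≡ᵇ n) ≡ true → m ≡ n
≡ᵇ-true⇒≡ m n e = ≡ᵇ⇒≡ m n (Equivalence.from T-≡ e)

≢⇒≡ᵇ-false : ∀ {m n} → ¬ m ≡ n → (m ≡ᵇ n) ≡ false
≢⇒≡ᵇ-false {m} {n} m≢n with m ≡ᵇ n in e
... | true  = ⊥-elim (m≢n (≡ᵇ-true⇒≡ m n e))
... | false = refl

true≢false : ¬ true ≡ false
true≢false ()

∧-true-right : ∀ a c → a ∧ c ≡ true → c ≡ true
∧-true-right true  c p = p
∧-true-right false c ()

not-false : ∀ a → not a ≡ false → a ≡ true
not-false true  _ = refl
not-false false ()

not-∨-false : ∀ a b → not a ∨ b ≡ false → a ≡ true × b ≡ false
not-∨-false true false _ = refl , refl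

∨-true : ∀ a c → a ∨ c ≡ true → a ≡ true ⊎ c ≡ true
∨-true true  c e = inj₁ refl
∨-true false c e = inj₂ e

All-∈ᵇ : ∀ {Q : ℕ → Set} {B : List ℕ} → All Q B → ∀ v → v ∈ᵇ B ≡ true → Q v
All-∈ᵇ {B = []}     []       v ()
All-∈ᵇ {Q} {x ∷ xs} (qx ∷ a) v e with v ≡ᵇ x in v≡x
... | true  = subst Q (Eq.sym (≡ᵇ-true⇒≡ v x v≡x)) qx
... | false = All-∈ᵇ a v e

∈ᵇ-↭ : ∀ {B B' : List ℕ} → B ↭ B' → ∀ v → v ∈ᵇ B ≡ v ∈ᵇ B'
∈ᵇ-↭ Perm.refl          v = refl
∈ᵇ-↭ (Perm.prep x p)    v = cong ((v ≡ᵇ x) ∨_) (∈ᵇ-↭ p v)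
∈ᵇ-↭ (Perm.swap {xs} x y p) v =
  Eq.trans (Eq.sym (∨-assoc (v ≡ᵇ x) (v ≡ᵇ y) (v ∈ᵇ xs)))
  (Eq.trans (cong (_∨ (v ∈ᵇ xs)) (∨-comm (v ≡ᵇ x) (v ≡ᵇ y)))
  (Eq.trans (∨-assoc (v ≡ᵇ y) (v ≡ᵇ x) (v ∈ᵇ xs))
            (cong (λ t → (v ≡ᵇ y) ∨ ((v ≡ᵇ x) ∨ t)) (∈ᵇ-↭ p v))))
∈ᵇ-↭ (Perm.trans p q)   v = Eq.trans (∈ᵇ-↭ p v) (∈ᵇ-↭ q v)

∈ᵇ-++ : ∀ v xs ys → v ∈ᵇ (xs ++ ys) ≡ v ∈ᵇ xs ∨ v ∈ᵇ ys
∈ᵇ-++ v []       ys = refl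
∈ᵇ-++ v (x ∷ xs) ys = Eq.trans (cong ((v ≡ᵇ x) ∨_) (∈ᵇ-++ v xs ys)) (Eq.sym (∨-assoc (v ≡ᵇ x) _ _))

∈ᵇ-upTo : ∀ v n → v < n → v ∈ᵇ upTo n ≡ true
∈ᵇ-upTo v (suc n) v<1+n =
  Eq.trans (cong (v ∈ᵇ_) (Eq.sym (upTo-∷ʳ n)))
           (Eq.trans (∈ᵇ-++ v (upTo n) [ n ]) (lastOrEarlier (m<1+n⇒m<n∨m≡n v<1+n)))
  where
  lastOrEarlier : v < n ⊎ v ≡ n → v ∈ᵇ upTo n ∨ v ∈ᵇ [ n ] ≡ true
  lastOrEarlier (inj₁ v<n)  rewrite ∈ᵇ-upTo v n v<n = refl
  lastOrEarlier (inj₂ refl) rewrite ≡ᵇ-refl v = ∨-zeroʳ _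

search : (p : ℕ → Bool) → ∀ xs →
         All (λ v → p v ≡ true) xs ⊎ Σ ℕ (λ v → v ∈ᵇ xs ≡ true × p v ≡ false)
search p []       = inj₁ []
search p (x ∷ xs) with p x in px
... | false = inj₂ (x , cong (_∨ (x ∈ᵇ xs)) (≡ᵇ-refl x) , px)
... | true with search p xs
...   | inj₁ all  = inj₁ (px ∷ all)
...   | inj₂ (v , v∈xs , pv) = inj₂ (v , Eq.trans (cong ((v ≡ᵇ x) ∨_) v∈xs) (∨-zeroʳ _) , pv)

filterᵇ-accept : ∀ (P : ℕ → Bool) {x} xs → P x ≡ true → filterᵇ P (x ∷ xs) ≡ x ∷ filterᵇ P xs
filterᵇ-accept P xs e rewrite e = refl

filterᵇ-reject : ∀ (P : ℕ → Bool) {x} xs → P x ≡ false → filterᵇ P (x ∷ xs) ≡ filterᵇ P xs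
filterᵇ-reject P xs e rewrite e = refl

filterᵇ-congᴬ : ∀ {P P' : ℕ → Bool} xs → All (λ x → P x ≡ P' x) xs → filterᵇ P xs ≡ filterᵇ P' xs
filterᵇ-congᴬ []       []      = refl
filterᵇ-congᴬ {P} {P'} (x ∷ xs) (e ∷ es) with P x | P' x
filterᵇ-congᴬ (x ∷ xs) (refl ∷ es) | true  | true  = cong (x ∷_) (filterᵇ-congᴬ xs es)
filterᵇ-congᴬ (x ∷ xs) (refl ∷ es) | false | false = filterᵇ-congᴬ xs es

filterᵇ-cong : ∀ {P P' : ℕ → Bool} → (∀ x → P x ≡ P' x) → ∀ xs → filterᵇ P xs ≡ filterᵇ P' xs
filterᵇ-cong e xs = filterᵇ-congᴬ xs (All.tabulate (λ {x} _ → e x))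

filterᵇ-All : ∀ (P : ℕ → Bool) xs → All (λ x → P x ≡ true) (filterᵇ P xs)
filterᵇ-All P []       = []
filterᵇ-All P (x ∷ xs) with P x in px
... | true  = px ∷ filterᵇ-All P xs
... | false = filterᵇ-All P xs

filterᵇ-filterᵇ : ∀ (A B : ℕ → Bool) xs → filterᵇ A (filterᵇ B xs) ≡ filterᵇ (λ x → B x ∧ A x) xs
filterᵇ-filterᵇ A B []       = refl
filterᵇ-filterᵇ A B (x ∷ xs) with B x | A x in ax
... | false | _     = filterᵇ-filterᵇ A B xs
... | true  | true  rewrite ax = cong (x ∷_) (filterᵇ-filterᵇ A B xs)
... | true  | false rewrite ax = filterᵇ-filterᵇ A B xs

∈ᵇ-filterᵇ : ∀ (P : ℕ → Bool) v X → v ∈ᵇ filterᵇ P X ≡ P v ∧ v ∈ᵇ X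
∈ᵇ-filterᵇ P v []       = Eq.sym (∧-zeroʳ (P v))
∈ᵇ-filterᵇ P v (x ∷ xs) with P x in px
... | true  with v ≡ᵇ x in v≡x
...   | true  rewrite ≡ᵇ-true⇒≡ v x v≡x | px = refl
...   | false = ∈ᵇ-filterᵇ P v xs
∈ᵇ-filterᵇ P v (x ∷ xs) | false with v ≡ᵇ x in v≡x
...   | true  rewrite ≡ᵇ-true⇒≡ v x v≡x | px = Eq.trans (∈ᵇ-filterᵇ P x xs) (cong (_∧ (x ∈ᵇ xs)) px)
...   | false = ∈ᵇ-filterᵇ P v xs

all-not-not : ∀ (P : ℕ → Bool) B → all (not ∘ not ∘ P) B ≡ all P B
all-not-not P B = cong and (map-cong (not-involutive ∘ P) B)

filterᵇ-not-not : ∀ (P : ℕ → Bool) xs → filterᵇ (not ∘ not ∘ P) xs ≡ filterᵇ P xs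
filterᵇ-not-not P = filterᵇ-cong (not-involutive ∘ P)

splitAt : ∀ c L → Unique L → c ∈ᵇ L ≡ true →
  Σ (List ℕ) λ pre → Σ (List ℕ) λ post →
    (L ≡ pre ++ c ∷ post) × All (λ x → (x ≡ᵇ c) ≡ false) (pre ++ post)
splitAt c []       u         ()
splitAt c (x ∷ xs) (x∉ ∷ u) c∈ with c ≡ᵇ x in c≡x
... | true with ≡ᵇ-true⇒≡ c x c≡x
...   | refl = [] , xs , refl , All.map (λ x≢c → ≢⇒≡ᵇ-false (λ e → x≢c (Eq.sym e))) x∉
splitAt c (x ∷ xs) (x∉ ∷ u) c∈ | false with splitAt c xs u c∈
... | pre , post , eq , fresh =
  x ∷ pre , post , cong (x ∷_) eq , ≢⇒≡ᵇ-false {x} {c} (λ { refl → true≢false (Eq.trans (Eq.sym (≡ᵇ-refl c)) c≡x) }) ∷ fresh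

splits : {A : Set} → List A → List (List A × List A)
splits []       = ([] , []) ∷ []
splits (v ∷ vs) = map (λ p → (v ∷ proj₁ p , proj₂ p)) (splits vs)
               ++ map (λ p → (proj₁ p , v ∷ proj₂ p)) (splits vs)

splits-All : ∀ {A : Set} {Q : A → Set} {vs} → All Q vs →
             All (λ p → All Q (proj₁ p) × All Q (proj₂ p)) (splits vs)
splits-All []       = ([] , []) ∷ []
splits-All (qv ∷ a) = ++⁺ (map⁺ (All.map (λ h → (qv ∷ proj₁ h) , proj₂ h) (splits-All a)))
                          (map⁺ (All.map (λ h → proj₁ h , (qv ∷ proj₂ h)) (splits-All a)))

selectBlock : {X : Set} → List X → List (X × List X)
selectBlock []      = []
selectBlock (B ∷ P) = (B , P) ∷ map (λ q → (proj₁ q , B ∷ proj₂ q)) (selectBlock P)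

selectBlockOrNone : List (List ℕ) → List (List ℕ × List (List ℕ))
selectBlockOrNone P = ([] , P) ∷ selectBlock P

partitionsWith : ℕ → List (List ℕ) → List (List (List ℕ))
partitionsWith v P = ([ v ] ∷ P) ∷ insertEach v P

module Algebraic {r ℓ : Level} (R : CommutativeRing r ℓ) where
  open CommutativeRing R renaming (refl to ≈-refl; sym to ≈-sym; trans to ≈-trans) hiding (zero)
  open Poly R
  open import Relation.Binary.Reasoning.Setoid setoid
  module +-Props = CommSemigroupProperties (CommutativeMonoid.commutativeSemigroup +-commutativeMonoid)
  module *-Props = CommSemigroupProperties (CommutativeMonoid.commutativeSemigroup *-commutativeMonoid)

  ≡⇒≈ : ∀ {x y} → x ≡ y → x ≈ y
  ≡⇒≈ refl = ≈-refl

  sumL : {A : Set} → (A → Carrier) → List A → Carrier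
  sumL f []       = 0#
  sumL f (x ∷ xs) = f x + sumL f xs

  sumL-cong : ∀ {A : Set} {f g : A → Carrier} xs → (∀ x → f x ≈ g x) → sumL f xs ≈ sumL g xs
  sumL-cong []       f≈g = ≈-refl
  sumL-cong (x ∷ xs) f≈g = +-cong (f≈g x) (sumL-cong xs f≈g)

  sumL-congᴬ : ∀ {A : Set} {P : A → Set} {f g : A → Carrier} {xs} →
               All P xs → (∀ x → P x → f x ≈ g x) → sumL f xs ≈ sumL g xs
  sumL-congᴬ []         f≈g = ≈-refl
  sumL-congᴬ (px ∷ pxs) f≈g = +-cong (f≈g _ px) (sumL-congᴬ pxs f≈g)

  sumL-++ : ∀ {A : Set} (f : A → Carrier) xs ys → sumL f (xs ++ ys) ≈ sumL f xs + sumL f ys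
  sumL-++ f []       ys = ≈-sym (+-identityˡ _)
  sumL-++ f (x ∷ xs) ys = ≈-trans (+-cong ≈-refl (sumL-++ f xs ys)) (≈-sym (+-assoc _ _ _))

  sumL-map : ∀ {A B : Set} (f : B → Carrier) (g : A → B) xs → sumL f (map g xs) ≡ sumL (f ∘ g) xs
  sumL-map f g []       = refl
  sumL-map f g (x ∷ xs) = cong (f (g x) +_) (sumL-map f g xs)

  sumL-concatMap : ∀ {A B : Set} (f : B → Carrier) (g : A → List B) xs →
                   sumL f (concatMap g xs) ≈ sumL (λ x → sumL f (g x)) xs
  sumL-concatMap f g []       = ≈-refl
  sumL-concatMap f g (x ∷ xs) = ≈-trans (sumL-++ f (g x) (concatMap g xs)) (+-cong ≈-refl (sumL-concatMap f g xs))

  sumL-+ : ∀ {A : Set} (f g : A → Carrier) xs → sumL (λ x → f x + g x) xs ≈ sumL f xs + sumL g xs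
  sumL-+ f g []       = ≈-sym (+-identityˡ _)
  sumL-+ f g (x ∷ xs) = ≈-trans (+-cong ≈-refl (sumL-+ f g xs)) (+-Props.interchange _ _ _ _)

  sumL-zero : ∀ {A : Set} {f : A → Carrier} xs → (∀ x → f x ≈ 0#) → sumL f xs ≈ 0#
  sumL-zero []       f≈0 = ≈-refl
  sumL-zero (x ∷ xs) f≈0 = ≈-trans (+-cong (f≈0 x) (sumL-zero xs f≈0)) (+-identityˡ _)

  sumL-*ˡ : ∀ {A : Set} a (f : A → Carrier) xs → a * sumL f xs ≈ sumL (λ x → a * f x) xs
  sumL-*ˡ a f []       = zeroʳ a
  sumL-*ˡ a f (x ∷ xs) = ≈-trans (distribˡ a _ _) (+-cong ≈-refl (sumL-*ˡ a f xs))

  sumL-*ʳ : ∀ {A : Set} a (f : A → Carrier) xs → sumL f xs * a ≈ sumL (λ x → f x * a) xs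
  sumL-*ʳ a f []       = zeroˡ a
  sumL-*ʳ a f (x ∷ xs) = ≈-trans (distribʳ a _ _) (+-cong ≈-refl (sumL-*ʳ a f xs))

  sumL-splits-∷ : ∀ {A : Set} (f : List A → List A → Carrier) v vs →
    sumL (λ p → f (proj₁ p) (proj₂ p)) (splits (v ∷ vs))
    ≈ sumL (λ p → f (v ∷ proj₁ p) (proj₂ p)) (splits vs) + sumL (λ p → f (proj₁ p) (v ∷ proj₂ p)) (splits vs)
  sumL-splits-∷ f v vs =
    ≈-trans (sumL-++ _ (map (λ p → (v ∷ proj₁ p , proj₂ p)) (splits vs)) (map (λ p → (proj₁ p , v ∷ proj₂ p)) (splits vs)))
            (+-cong (≡⇒≈ (sumL-map _ _ (splits vs))) (≡⇒≈ (sumL-map _ _ (splits vs))))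

  _≐_ : (ℕ → Carrier) → (ℕ → Carrier) → Set ℓ
  p ≐ q = ∀ k → p k ≈ q k

  cv : (ℕ → Carrier) → (ℕ → Carrier) → ℕ → Carrier
  cv p q zero    = p 0 * q 0
  cv p q (suc k) = p 0 * q (suc k) + cv (p ∘ suc) q k

  conv≐cv : ∀ p q → conv p q ≐ cv p q
  conv≐cv p q k = ≈-trans (≡⇒≈ (cong Σᴿ (map-upTo (λ i → p i * q (k ∸ i)) (suc k)))) (unfold p k)
    where
    unfold : ∀ p k → Σᴿ (applyUpTo (λ i → p i * q (k ∸ i)) (suc k)) ≈ cv p q k
    unfold p zero    = +-identityʳ _
    unfold p (suc k) = +-cong ≈-refl (unfold (p ∘ suc) k)

  cv-cong : ∀ {p p' q q'} → p ≐ p' → q ≐ q' → cv p q ≐ cv p' q'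
  cv-cong hp hq zero    = *-cong (hp 0) (hq 0)
  cv-cong hp hq (suc k) = +-cong (*-cong (hp 0) (hq (suc k))) (cv-cong (hp ∘ suc) hq k)

  shift-cong : ∀ {p q} → p ≐ q → shift p ≐ shift q
  shift-cong h zero    = ≈-refl
  shift-cong h (suc k) = h k

  cv-comm : ∀ p q → cv p q ≐ cv q p
  cv-comm p q zero          = *-comm _ _
  cv-comm p q (suc zero)    = ≈-trans (+-comm _ _) (+-cong (*-comm _ _) (*-comm _ _))
  cv-comm p q (suc (suc k)) = begin
      p 0 * q (suc (suc k)) + cv (p ∘ suc) q (suc k)
    ≈⟨ +-cong ≈-refl (cv-comm (p ∘ suc) q (suc k)) ⟩
      p 0 * q (suc (suc k)) + (q 0 * p (suc (suc k)) + cv (q ∘ suc) (p ∘ suc) k)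
    ≈⟨ +-Props.x∙yz≈y∙xz _ _ _ ⟩
      q 0 * p (suc (suc k)) + (p 0 * q (suc (suc k)) + cv (q ∘ suc) (p ∘ suc) k)
    ≈⟨ +-cong ≈-refl (+-cong ≈-refl (cv-comm (q ∘ suc) (p ∘ suc) k)) ⟩
      q 0 * p (suc (suc k)) + (p 0 * q (suc (suc k)) + cv (p ∘ suc) (q ∘ suc) k)
    ≈⟨ +-cong ≈-refl (≈-sym (cv-comm (q ∘ suc) p (suc k))) ⟩
      q 0 * p (suc (suc k)) + cv (q ∘ suc) p (suc k)
    ∎

  cv-shiftˡ : ∀ p q → cv (shift p) q ≐ shift (cv p q)
  cv-shiftˡ p q zero    = zeroˡ _
  cv-shiftˡ p q (suc k) = ≈-trans (+-cong (zeroˡ _) ≈-refl) (+-identityˡ _)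

  cv-shiftʳ : ∀ p q → cv p (shift q) ≐ shift (cv p q)
  cv-shiftʳ p q k = ≈-trans (cv-comm p (shift q) k)
                   (≈-trans (cv-shiftˡ q p k) (shift-cong (cv-comm q p) k))

  cv-zeroˡ : ∀ q → cv (λ _ → 0#) q ≐ (λ _ → 0#)
  cv-zeroˡ q zero    = zeroˡ _
  cv-zeroˡ q (suc k) = ≈-trans (+-cong (zeroˡ _) (cv-zeroˡ q k)) (+-identityˡ _)

  IsOne : (ℕ → Carrier) → Set ℓ
  IsOne e = (e 0 ≈ 1#) × (∀ k → e (suc k) ≈ 0#)

  cv-identityˡ : ∀ e q → IsOne e → cv e q ≐ q
  cv-identityˡ e q (e₀ , eₛ) zero    = ≈-trans (*-cong e₀ ≈-refl) (*-identityˡ _)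
  cv-identityˡ e q (e₀ , eₛ) (suc k) =
    ≈-trans (+-cong (≈-trans (*-cong e₀ ≈-refl) (*-identityˡ _)) (≈-trans (cv-cong eₛ (λ _ → ≈-refl) k) (cv-zeroˡ q k)))
            (+-identityʳ _)

  cv-+ˡ : ∀ p q r → cv (λ i → p i + q i) r ≐ (λ k → cv p r k + cv q r k)
  cv-+ˡ p q r zero    = distribʳ _ _ _
  cv-+ˡ p q r (suc k) = ≈-trans (+-cong (distribʳ _ _ _) (cv-+ˡ (p ∘ suc) (q ∘ suc) r k)) (+-Props.interchange _ _ _ _)

  cv-*ˡ : ∀ a p q → cv (λ i → a * p i) q ≐ (λ k → a * cv p q k)
  cv-*ˡ a p q zero    = *-assoc _ _ _
  cv-*ˡ a p q (suc k) = ≈-trans (+-cong (*-assoc _ _ _) (cv-*ˡ a (p ∘ suc) q k)) (≈-sym (distribˡ _ _ _))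

  cv-*ʳ : ∀ a p q → cv p (λ i → a * q i) ≐ (λ k → a * cv p q k)
  cv-*ʳ a p q k = ≈-trans (cv-comm p _ k) (≈-trans (cv-*ˡ a q p k) (*-cong ≈-refl (cv-comm q p k)))

  cv-sumˡ : ∀ {A : Set} (f : A → ℕ → Carrier) xs q →
    cv (λ i → sumL (λ x → f x i) xs) q ≐ (λ k → sumL (λ x → cv (f x) q k) xs)
  cv-sumˡ f xs q zero    = sumL-*ʳ _ _ xs
  cv-sumˡ f xs q (suc k) = ≈-trans (+-cong (sumL-*ʳ _ _ xs) (cv-sumˡ (λ x i → f x (suc i)) xs q k)) (≈-sym (sumL-+ _ _ xs))


  -- Inserting u into a block of P and then singling out a block amounts
  -- to singling out a block B of P and then either putting u into B or
  -- inserting u into one of the remaining blocks.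
  selectBlock-insertEach : ∀ u P (F : List ℕ → List (List ℕ) → Carrier) →
    sumL (λ P' → sumL (uncurry F) (selectBlock P')) (insertEach u P)
    ≈ sumL (λ q → F (u ∷ proj₁ q) (proj₂ q) + sumL (F (proj₁ q)) (insertEach u (proj₂ q))) (selectBlock P)
  selectBlock-insertEach u []      F = ≈-refl
  selectBlock-insertEach u (B ∷ P) F = begin
      (F (u ∷ B) P + sumL (uncurry F) (map (λ q → (proj₁ q , (u ∷ B) ∷ proj₂ q)) (selectBlock P)))
        + sumL φ (map (B ∷_) (insertEach u P))
    ≈⟨ +-cong (+-cong ≈-refl (≡⇒≈ (sumL-map (uncurry F) _ (selectBlock P)))) (≡⇒≈ (sumL-map φ _ (insertEach u P))) ⟩
      (a + b) + sumL (λ P' → F B P' + sumL (uncurry F) (map (λ q → (proj₁ q , B ∷ proj₂ q)) (selectBlock P'))) (insertEach u P)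
    ≈⟨ +-cong ≈-refl (≈-trans (sumL-cong (insertEach u P) (λ P' → +-cong ≈-refl (≡⇒≈ (sumL-map (uncurry F) _ (selectBlock P')))))
                              (sumL-+ (F B) _ (insertEach u P))) ⟩
      (a + b) + (c' + sumL (λ P' → sumL (λ q → F (proj₁ q) (B ∷ proj₂ q)) (selectBlock P')) (insertEach u P))
    ≈⟨ +-cong ≈-refl (+-cong ≈-refl (≈-trans (selectBlock-insertEach u P (λ C Q → F C (B ∷ Q))) (sumL-+ _ _ (selectBlock P)))) ⟩
      (a + b) + (c' + (d + e))
    ≈⟨ ≈-trans (+-Props.interchange a b c' (d + e)) (+-cong ≈-refl (+-Props.x∙yz≈y∙xz b d e)) ⟩
      (a + c') + (d + (b + e))
    ≈⟨ +-cong ≈-refl (≈-sym (≈-trans (sumL-+ _ _ (selectBlock P)) (+-cong ≈-refl (sumL-+ _ _ (selectBlock P))))) ⟩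
      (a + c') + sumL (λ q → F (u ∷ proj₁ q) (B ∷ proj₂ q) + (F (proj₁ q) ((u ∷ B) ∷ proj₂ q)
                      + sumL (λ Q → F (proj₁ q) (B ∷ Q)) (insertEach u (proj₂ q)))) (selectBlock P)
    ≈⟨ +-cong ≈-refl (sumL-cong (selectBlock P) (λ q → +-cong ≈-refl (+-cong ≈-refl
         (≡⇒≈ (Eq.sym (sumL-map (F (proj₁ q)) (B ∷_) (insertEach u (proj₂ q)))))))) ⟩
      (a + c') + sumL (λ q → ψ (proj₁ q , B ∷ proj₂ q)) (selectBlock P)
    ≈⟨ +-cong ≈-refl (≡⇒≈ (Eq.sym (sumL-map ψ _ (selectBlock P)))) ⟩
      (a + c') + sumL ψ (map (λ q → (proj₁ q , B ∷ proj₂ q)) (selectBlock P))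
    ∎
    where
    φ : List (List ℕ) → Carrier
    φ P' = sumL (uncurry F) (selectBlock P')
    ψ : List ℕ × List (List ℕ) → Carrier
    ψ q = F (u ∷ proj₁ q) (proj₂ q) + sumL (F (proj₁ q)) (insertEach u (proj₂ q))
    a b c' d e : Carrier
    a = F (u ∷ B) P
    b = sumL (λ q → F (proj₁ q) ((u ∷ B) ∷ proj₂ q)) (selectBlock P)
    c' = sumL (F B) (insertEach u P)
    d = sumL (λ q → F (u ∷ proj₁ q) (B ∷ proj₂ q)) (selectBlock P)
    e = sumL (λ q → sumL (λ Q → F (proj₁ q) (B ∷ Q)) (insertEach u (proj₂ q))) (selectBlock P)

  -- Choosing a partition of vs together with one of its blocks (or the
  -- empty block) is the same as choosing a sublist T of vs and then a
  -- partition Q of the remaining entries R.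
  partitions-selectBlock : ∀ vs (F : List ℕ → List (List ℕ) → Carrier) →
    sumL (λ P → sumL (uncurry F) (selectBlockOrNone P)) (partitions vs)
    ≈ sumL (λ p → sumL (F (proj₁ p)) (partitions (proj₂ p))) (splits vs)
  partitions-selectBlock []       F = ≈-refl
  partitions-selectBlock (u ∷ us) F = begin
      sumL Φ (concatMap (partitionsWith u) (partitions us))
    ≈⟨ sumL-concatMap Φ (partitionsWith u) (partitions us) ⟩
      sumL (λ P → sumL Φ (partitionsWith u P)) (partitions us)
    ≈⟨ sumL-cong (partitions us) perPartition ⟩
      sumL (λ P → sumL (λ q → F (u ∷ proj₁ q) (proj₂ q) + G (proj₁ q) (proj₂ q)) (selectBlockOrNone P)) (partitions us)
    ≈⟨ ≈-trans (sumL-cong (partitions us) (λ P → sumL-+ _ _ (selectBlockOrNone P))) (sumL-+ _ _ (partitions us)) ⟩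
      sumL (λ P → sumL (uncurry (λ T Q → F (u ∷ T) Q)) (selectBlockOrNone P)) (partitions us)
        + sumL (λ P → sumL (uncurry G) (selectBlockOrNone P)) (partitions us)
    ≈⟨ +-cong (partitions-selectBlock us (λ T Q → F (u ∷ T) Q)) (partitions-selectBlock us G) ⟩
      sumL (λ p → sumL (F (u ∷ proj₁ p)) (partitions (proj₂ p))) (splits us)
        + sumL (λ p → sumL (G (proj₁ p)) (partitions (proj₂ p))) (splits us)
    ≈⟨ +-cong ≈-refl (sumL-cong (splits us) (λ p → ≈-sym (sumL-concatMap (F (proj₁ p)) (partitionsWith u) (partitions (proj₂ p))))) ⟩
      sumL (λ p → ρ (u ∷ proj₁ p , proj₂ p)) (splits us) + sumL (λ p → ρ (proj₁ p , u ∷ proj₂ p)) (splits us)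
    ≈⟨ ≈-sym (sumL-splits-∷ (λ T R → ρ (T , R)) u us) ⟩
      sumL ρ (splits (u ∷ us))
    ∎
    where
    Φ : List (List ℕ) → Carrier
    Φ P = sumL (uncurry F) (selectBlockOrNone P)
    G : List ℕ → List (List ℕ) → Carrier
    G C Q = sumL (F C) (partitionsWith u Q)
    ρ : List ℕ × List ℕ → Carrier
    ρ p = sumL (F (proj₁ p)) (partitions (proj₂ p))
    regroup : ∀ a b c d e f → (a + (b + c)) + (d + (e + f)) ≈ (b + (a + d)) + (e + (c + f))
    regroup a b c d e f = begin
        (a + (b + c)) + (d + (e + f))
      ≈⟨ +-cong (+-Props.x∙yz≈y∙xz a b c) ≈-refl ⟩
        (b + (a + c)) + (d + (e + f))
      ≈⟨ +-assoc _ _ _ ⟩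
        b + ((a + c) + (d + (e + f)))
      ≈⟨ +-cong ≈-refl (≈-trans (+-Props.interchange a c d (e + f)) (+-cong ≈-refl (+-Props.x∙yz≈y∙xz c e f))) ⟩
        b + ((a + d) + (e + (c + f)))
      ≈⟨ ≈-sym (+-assoc _ _ _) ⟩
        (b + (a + d)) + (e + (c + f))
      ∎
    perPartition : ∀ P → sumL Φ (partitionsWith u P)
                         ≈ sumL (λ q → F (u ∷ proj₁ q) (proj₂ q) + G (proj₁ q) (proj₂ q)) (selectBlockOrNone P)
    perPartition P = begin
        (F [] ([ u ] ∷ P) + (F [ u ] P + sumL (uncurry F) (map (λ q → (proj₁ q , [ u ] ∷ proj₂ q)) (selectBlock P))))
          + sumL Φ (insertEach u P)
      ≈⟨ +-cong (+-cong ≈-refl (+-cong ≈-refl (≡⇒≈ (sumL-map (uncurry F) _ (selectBlock P))))) (sumL-+ _ _ (insertEach u P)) ⟩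
        (a + (b + c')) + (d + sumL (λ P' → sumL (uncurry F) (selectBlock P')) (insertEach u P))
      ≈⟨ +-cong ≈-refl (+-cong ≈-refl (≈-trans (selectBlock-insertEach u P F) (sumL-+ _ _ (selectBlock P)))) ⟩
        (a + (b + c')) + (d + (e + f))
      ≈⟨ regroup a b c' d e f ⟩
        (b + (a + d)) + (e + (c' + f))
      ≈⟨ +-cong ≈-refl (≈-sym (≈-trans (sumL-+ _ _ (selectBlock P)) (+-cong ≈-refl (sumL-+ _ _ (selectBlock P))))) ⟩
        (b + (a + d)) + sumL (λ q → F (u ∷ proj₁ q) (proj₂ q) + G (proj₁ q) (proj₂ q)) (selectBlock P)
      ∎
      where
      a b c' d e f : Carrier
      a = F [] ([ u ] ∷ P)
      b = F [ u ] P
      c' = sumL (λ q → F (proj₁ q) ([ u ] ∷ proj₂ q)) (selectBlock P)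
      d = sumL (F []) (insertEach u P)
      e = sumL (λ q → F (u ∷ proj₁ q) (proj₂ q)) (selectBlock P)
      f = sumL (λ q → sumL (F (proj₁ q)) (insertEach u (proj₂ q))) (selectBlock P)

  δ : ℕ → ℕ → Carrier
  δ k n = if n ≡ᵇ k then 1# else 0#

  blockProduct : (List ℕ → Carrier) → List (List ℕ) → Carrier
  blockProduct w P = Πᴿ (map w P)

  Z : (List ℕ → Carrier) → List ℕ → ℕ → Carrier
  Z w L k = sumL (λ P → δ k (length P) * blockProduct w P) (partitions L)

  insertEach-blockProduct : ∀ w v P (ψ : ℕ → Carrier) →
    sumL (λ P' → ψ (length P') * blockProduct w P') (insertEach v P)
    ≈ sumL (λ q → ψ (suc (length (proj₂ q))) * (w (v ∷ proj₁ q) * blockProduct w (proj₂ q))) (selectBlock P)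
  insertEach-blockProduct w v []      ψ = ≈-refl
  insertEach-blockProduct w v (B ∷ P) ψ = +-cong ≈-refl (begin
      sumL (λ P' → ψ (length P') * blockProduct w P') (map (B ∷_) (insertEach v P))
    ≈⟨ ≡⇒≈ (sumL-map _ _ (insertEach v P)) ⟩
      sumL (λ P' → ψ (suc (length P')) * (w B * blockProduct w P')) (insertEach v P)
    ≈⟨ sumL-cong (insertEach v P) (λ P' → *-Props.x∙yz≈y∙xz _ _ _) ⟩
      sumL (λ P' → w B * (ψ (suc (length P')) * blockProduct w P')) (insertEach v P)
    ≈⟨ ≈-sym (sumL-*ˡ (w B) _ (insertEach v P)) ⟩
      w B * sumL (λ P' → ψ (suc (length P')) * blockProduct w P') (insertEach v P)
    ≈⟨ *-cong ≈-refl (insertEach-blockProduct w v P (ψ ∘ suc)) ⟩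
      w B * sumL (λ q → ψ (suc (suc (length (proj₂ q)))) * (w (v ∷ proj₁ q) * blockProduct w (proj₂ q))) (selectBlock P)
    ≈⟨ sumL-*ˡ (w B) _ (selectBlock P) ⟩
      sumL (λ q → w B * (ψ (suc (suc (length (proj₂ q)))) * (w (v ∷ proj₁ q) * blockProduct w (proj₂ q)))) (selectBlock P)
    ≈⟨ sumL-cong (selectBlock P) (λ q → ≈-trans (*-Props.x∙yz≈y∙xz _ _ _) (*-cong ≈-refl (*-Props.x∙yz≈y∙xz _ _ _))) ⟩
      sumL (λ q → ψ (suc (suc (length (proj₂ q)))) * (w (v ∷ proj₁ q) * (w B * blockProduct w (proj₂ q)))) (selectBlock P)
    ≈⟨ ≡⇒≈ (Eq.sym (sumL-map _ _ (selectBlock P))) ⟩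
      sumL (λ q → ψ (suc (length (proj₂ q))) * (w (v ∷ proj₁ q) * blockProduct w (proj₂ q)))
           (map (λ q → (proj₁ q , B ∷ proj₂ q)) (selectBlock P))
    ∎)

  -- Expansion along the block of the first entry v: that block is v ∷ T
  -- for a sublist T of vs, and the other blocks partition the rest R.
  Z-headBlock : ∀ w v vs k →
    Z w (v ∷ vs) k ≈ sumL (λ p → sumL (λ Q → δ k (suc (length Q)) * (w (v ∷ proj₁ p) * blockProduct w Q))
                                      (partitions (proj₂ p))) (splits vs)
  Z-headBlock w v vs k = begin
      sumL φ (concatMap (partitionsWith v) (partitions vs))
    ≈⟨ sumL-concatMap φ (partitionsWith v) (partitions vs) ⟩
      sumL (λ P → φ ([ v ] ∷ P) + sumL φ (insertEach v P)) (partitions vs)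
    ≈⟨ sumL-cong (partitions vs) (λ P → +-cong ≈-refl (insertEach-blockProduct w v P (δ k))) ⟩
      sumL (λ P → sumL (uncurry F) (selectBlockOrNone P)) (partitions vs)
    ≈⟨ partitions-selectBlock vs F ⟩
      sumL (λ p → sumL (F (proj₁ p)) (partitions (proj₂ p))) (splits vs)
    ∎
    where
    φ : List (List ℕ) → Carrier
    φ P = δ k (length P) * blockProduct w P
    F : List ℕ → List (List ℕ) → Carrier
    F T Q = δ k (suc (length Q)) * (w (v ∷ T) * blockProduct w Q)

  headSum : (List ℕ → Carrier) → ℕ → List ℕ → ℕ → Carrier
  headSum w v vs j = sumL (λ p → w (v ∷ proj₁ p) * Z w (proj₂ p) j) (splits vs)

  Z-[] : ∀ w → IsOne (Z w [])
  Z-[] w = ≈-trans (+-identityʳ _) (*-identityʳ _) , λ k → ≈-trans (+-identityʳ _) (zeroˡ _)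

  Z-∷ : ∀ w v vs → Z w (v ∷ vs) ≐ shift (headSum w v vs)
  Z-∷ w v vs zero    = ≈-trans (Z-headBlock w v vs 0)
    (sumL-zero (splits vs) (λ p → sumL-zero (partitions (proj₂ p)) (λ Q → zeroˡ _)))
  Z-∷ w v vs (suc k) = ≈-trans (Z-headBlock w v vs (suc k)) (sumL-cong (splits vs) (λ p →
    ≈-trans (sumL-cong (partitions (proj₂ p)) (λ Q → *-Props.x∙yz≈y∙xz _ _ _))
            (≈-sym (sumL-*ˡ _ _ (partitions (proj₂ p))))))

  Z-congᵂ : ∀ {Q : ℕ → Set} {w w' : List ℕ → Carrier} → (∀ B → All Q B → w B ≈ w' B) →
            ∀ L → All Q L → Z w L ≐ Z w' L
  Z-congᵂ         w≈w' []       a        k       = ≈-refl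
  Z-congᵂ {w = w} {w'} w≈w' (v ∷ vs) (qv ∷ a) zero    =
    ≈-trans (Z-∷ w v vs 0) (≈-sym (Z-∷ w' v vs 0))
  Z-congᵂ {w = w} {w'} w≈w' (v ∷ vs) (qv ∷ a) (suc k) =
    ≈-trans (Z-∷ w v vs (suc k)) (≈-trans
      (sumL-congᴬ (splits-All a) (λ p qp → *-cong (w≈w' (v ∷ proj₁ p) (qv ∷ proj₁ qp)) (Z-congᵂ w≈w' (proj₂ p) (proj₂ qp) k)))
      (≈-sym (Z-∷ w' v vs (suc k))))

  -- Splitting twice is symmetric in the first two parts: both sides sum
  -- over all ways of distributing L into three labelled sublists.
  splits-splits-swap : ∀ L (F : List ℕ → List ℕ → List ℕ → Carrier) →
    sumL (λ p → sumL (λ p' → F (proj₁ p) (proj₁ p') (proj₂ p')) (splits (proj₂ p))) (splits L)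
    ≈ sumL (λ p → sumL (λ p' → F (proj₁ p') (proj₁ p) (proj₂ p')) (splits (proj₂ p))) (splits L)
  splits-splits-swap []      F = ≈-refl
  splits-splits-swap (v ∷ L) F = begin
      sumL (λ p → g (proj₁ p) (proj₂ p)) (splits (v ∷ L))
    ≈⟨ sumL-splits-∷ g v L ⟩
      sumL (λ p → g (v ∷ proj₁ p) (proj₂ p)) (splits L) + sumL (λ p → g (proj₁ p) (v ∷ proj₂ p)) (splits L)
    ≈⟨ +-cong ≈-refl (≈-trans (sumL-cong (splits L) (λ p → sumL-splits-∷ (F (proj₁ p)) v (proj₂ p))) (sumL-+ _ _ (splits L))) ⟩
      sumL (λ p → g (v ∷ proj₁ p) (proj₂ p)) (splits L) + (sumL (λ p → sumL (λ p' → F (proj₁ p) (v ∷ proj₁ p') (proj₂ p')) (splits (proj₂ p))) (splits L)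
        + sumL (λ p → sumL (λ p' → F (proj₁ p) (proj₁ p') (v ∷ proj₂ p')) (splits (proj₂ p))) (splits L))
    ≈⟨ +-cong (splits-splits-swap L (λ T T' R → F (v ∷ T) T' R))
              (+-cong (splits-splits-swap L (λ T T' R → F T (v ∷ T') R)) (splits-splits-swap L (λ T T' R → F T T' (v ∷ R)))) ⟩
      a₂ + (b₂ + c₂)
    ≈⟨ +-Props.x∙yz≈y∙xz _ _ _ ⟩
      b₂ + (a₂ + c₂)
    ≈⟨ +-cong ≈-refl (≈-sym (≈-trans (sumL-cong (splits L) (λ p → sumL-splits-∷ (λ T R → F T (proj₁ p) R) v (proj₂ p)))
                                     (sumL-+ _ _ (splits L)))) ⟩
      sumL (λ p → h (v ∷ proj₁ p) (proj₂ p)) (splits L) + sumL (λ p → h (proj₁ p) (v ∷ proj₂ p)) (splits L)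
    ≈⟨ ≈-sym (sumL-splits-∷ h v L) ⟩
      sumL (λ p → h (proj₁ p) (proj₂ p)) (splits (v ∷ L))
    ∎
    where
    g h : List ℕ → List ℕ → Carrier
    g T R  = sumL (λ p' → F T (proj₁ p') (proj₂ p')) (splits R)
    h T' R = sumL (λ p' → F (proj₁ p') T' (proj₂ p')) (splits R)
    a₂ b₂ c₂ : Carrier
    a₂ = sumL (λ p → sumL (λ p' → F (v ∷ proj₁ p') (proj₁ p) (proj₂ p')) (splits (proj₂ p))) (splits L)
    b₂ = sumL (λ p → sumL (λ p' → F (proj₁ p') (v ∷ proj₁ p) (proj₂ p')) (splits (proj₂ p))) (splits L)
    c₂ = sumL (λ p → sumL (λ p' → F (proj₁ p') (proj₁ p) (v ∷ proj₂ p')) (splits (proj₂ p))) (splits L)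

  sumL-splits-↭ : ∀ {L L'} → L ↭ L' → (F : List ℕ → List ℕ → Carrier) →
    (∀ {T T' R R'} → T ↭ T' → R ↭ R' → F T R ≈ F T' R') →
    sumL (uncurry F) (splits L) ≈ sumL (uncurry F) (splits L')
  sumL-splits-↭ Perm.refl F F-↭ = ≈-refl
  sumL-splits-↭ (Perm.prep {xs} {ys} x p) F F-↭ = begin
      sumL (uncurry F) (splits (x ∷ xs))
    ≈⟨ sumL-splits-∷ F x xs ⟩
      sumL (λ q → F (x ∷ proj₁ q) (proj₂ q)) (splits xs) + sumL (λ q → F (proj₁ q) (x ∷ proj₂ q)) (splits xs)
    ≈⟨ +-cong (sumL-splits-↭ p (λ T R → F (x ∷ T) R) (λ t r → F-↭ (Perm.prep x t) r))
              (sumL-splits-↭ p (λ T R → F T (x ∷ R)) (λ t r → F-↭ t (Perm.prep x r))) ⟩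
      sumL (λ q → F (x ∷ proj₁ q) (proj₂ q)) (splits ys) + sumL (λ q → F (proj₁ q) (x ∷ proj₂ q)) (splits ys)
    ≈⟨ ≈-sym (sumL-splits-∷ F x ys) ⟩
      sumL (uncurry F) (splits (x ∷ ys))
    ∎
  sumL-splits-↭ (Perm.swap {xs} {ys} x y p) F F-↭ = begin
      sumL (uncurry F) (splits (x ∷ y ∷ xs))
    ≈⟨ ≈-trans (sumL-splits-∷ F x (y ∷ xs)) (+-cong (sumL-splits-∷ (λ T R → F (x ∷ T) R) y xs) (sumL-splits-∷ (λ T R → F T (x ∷ R)) y xs)) ⟩
      (s xs (λ T R → F (x ∷ y ∷ T) R) + s xs (λ T R → F (x ∷ T) (y ∷ R)))
        + (s xs (λ T R → F (y ∷ T) (x ∷ R)) + s xs (λ T R → F T (x ∷ y ∷ R)))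
    ≈⟨ +-cong (+-cong (under (λ T R → F (x ∷ y ∷ T) R) (λ T R → F (y ∷ x ∷ T) R) (λ t r → F-↭ (Perm.swap x y t) r))
                      (under (λ T R → F (x ∷ T) (y ∷ R)) (λ T R → F (x ∷ T) (y ∷ R)) (λ t r → F-↭ (Perm.prep x t) (Perm.prep y r))))
              (+-cong (under (λ T R → F (y ∷ T) (x ∷ R)) (λ T R → F (y ∷ T) (x ∷ R)) (λ t r → F-↭ (Perm.prep y t) (Perm.prep x r)))
                      (under (λ T R → F T (x ∷ y ∷ R)) (λ T R → F T (y ∷ x ∷ R)) (λ t r → F-↭ t (Perm.swap x y r)))) ⟩
      (s ys (λ T R → F (y ∷ x ∷ T) R) + s ys (λ T R → F (x ∷ T) (y ∷ R)))
        + (s ys (λ T R → F (y ∷ T) (x ∷ R)) + s ys (λ T R → F T (y ∷ x ∷ R)))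
    ≈⟨ +-Props.interchange _ _ _ _ ⟩
      (s ys (λ T R → F (y ∷ x ∷ T) R) + s ys (λ T R → F (y ∷ T) (x ∷ R)))
        + (s ys (λ T R → F (x ∷ T) (y ∷ R)) + s ys (λ T R → F T (y ∷ x ∷ R)))
    ≈⟨ ≈-sym (≈-trans (sumL-splits-∷ F y (x ∷ ys)) (+-cong (sumL-splits-∷ (λ T R → F (y ∷ T) R) x ys) (sumL-splits-∷ (λ T R → F T (y ∷ R)) x ys))) ⟩
      sumL (uncurry F) (splits (y ∷ x ∷ ys))
    ∎
    where
    s : List ℕ → (List ℕ → List ℕ → Carrier) → Carrier
    s zs G = sumL (uncurry G) (splits zs)
    under : ∀ (G G' : List ℕ → List ℕ → Carrier) → (∀ {T T' R R'} → T ↭ T' → R ↭ R' → G T R ≈ G' T' R') → s xs G ≈ s ys G'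
    under G G' G↭G' = ≈-trans (sumL-splits-↭ p G (λ t r → ≈-trans (G↭G' t r) (≈-sym (G↭G' Perm.refl Perm.refl))))
                                 (sumL-cong (splits ys) (λ q → G↭G' Perm.refl Perm.refl))
  sumL-splits-↭ (Perm.trans p q) F F-↭ = ≈-trans (sumL-splits-↭ p F F-↭) (sumL-splits-↭ q F F-↭)

  RespectsPerm : (List ℕ → Carrier) → Set ℓ
  RespectsPerm w = ∀ {B B'} → B ↭ B' → w B ≈ w B'

  -- Exchanging the first two entries does not change Z: partitions with
  -- x and y in one block match directly, those with x and y in different
  -- blocks match by exchanging the roles of the two blocks.
  Z-swap : ∀ {w} → RespectsPerm w → ∀ x y L → Z w (x ∷ y ∷ L) ≐ Z w (y ∷ x ∷ L)
  Z-swap {w} w-↭ x y L zero    = ≈-trans (Z-∷ w x (y ∷ L) 0) (≈-sym (Z-∷ w y (x ∷ L) 0))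
  Z-swap {w} w-↭ x y L (suc k) = begin
      Z w (x ∷ y ∷ L) (suc k)
    ≈⟨ ≈-trans (Z-∷ w x (y ∷ L) (suc k)) (sumL-splits-∷ (λ T R → w (x ∷ T) * Z w R k) y L) ⟩
      sumL (λ p → w (x ∷ y ∷ proj₁ p) * Z w (proj₂ p) k) (splits L) + apart x y k
    ≈⟨ +-cong (sumL-cong (splits L) (λ p → *-cong (w-↭ (Perm.swap x y Perm.refl)) ≈-refl)) (apart-sym k) ⟩
      sumL (λ p → w (y ∷ x ∷ proj₁ p) * Z w (proj₂ p) k) (splits L) + apart y x k
    ≈⟨ ≈-sym (≈-trans (Z-∷ w y (x ∷ L) (suc k)) (sumL-splits-∷ (λ T R → w (y ∷ T) * Z w R k) x L)) ⟩
      Z w (y ∷ x ∷ L) (suc k)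
    ∎
    where
    -- the partitions in which the blocks of x and y differ
    apart : ℕ → ℕ → ℕ → Carrier
    apart x y j = sumL (λ p → w (x ∷ proj₁ p) * Z w (y ∷ proj₂ p) j) (splits L)
    apart-expand : ∀ x y j → apart x y (suc j) ≈
      sumL (λ p → sumL (λ p' → w (x ∷ proj₁ p) * (w (y ∷ proj₁ p') * Z w (proj₂ p') j)) (splits (proj₂ p))) (splits L)
    apart-expand x y j = sumL-cong (splits L) (λ p →
      ≈-trans (*-cong ≈-refl (Z-∷ w y (proj₂ p) (suc j))) (sumL-*ˡ _ _ (splits (proj₂ p))))
    apart-sym : ∀ j → apart x y j ≈ apart y x j
    apart-sym zero    = ≈-trans (sumL-zero (splits L) (λ p → ≈-trans (*-cong ≈-refl (Z-∷ w y (proj₂ p) 0)) (zeroʳ _)))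
                       (≈-sym (sumL-zero (splits L) (λ p → ≈-trans (*-cong ≈-refl (Z-∷ w x (proj₂ p) 0)) (zeroʳ _))))
    apart-sym (suc j) = begin
        apart x y (suc j)
      ≈⟨ apart-expand x y j ⟩
        sumL (λ p → sumL (λ p' → w (x ∷ proj₁ p) * (w (y ∷ proj₁ p') * Z w (proj₂ p') j)) (splits (proj₂ p))) (splits L)
      ≈⟨ splits-splits-swap L (λ T T' R → w (x ∷ T) * (w (y ∷ T') * Z w R j)) ⟩
        sumL (λ p → sumL (λ p' → w (x ∷ proj₁ p') * (w (y ∷ proj₁ p) * Z w (proj₂ p') j)) (splits (proj₂ p))) (splits L)
      ≈⟨ sumL-cong (splits L) (λ p → sumL-cong (splits (proj₂ p)) (λ p' → *-Props.x∙yz≈y∙xz _ _ _)) ⟩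
        sumL (λ p → sumL (λ p' → w (y ∷ proj₁ p) * (w (x ∷ proj₁ p') * Z w (proj₂ p') j)) (splits (proj₂ p))) (splits L)
      ≈⟨ ≈-sym (apart-expand y x j) ⟩
        apart y x (suc j)
      ∎

  Z-↭ : ∀ {w} → RespectsPerm w → ∀ k {L L'} → L ↭ L' → Z w L k ≈ Z w L' k
  Z-↭-prep : ∀ {w} → RespectsPerm w → ∀ k x {xs ys} → xs ↭ ys → Z w (x ∷ xs) k ≈ Z w (x ∷ ys) k

  Z-↭ w-↭ k Perm.refl                = ≈-refl
  Z-↭ w-↭ k (Perm.prep x p)          = Z-↭-prep w-↭ k x p
  Z-↭ w-↭ k (Perm.swap {xs} x y p)   = ≈-trans (Z-swap w-↭ x y xs k) (Z-↭-prep w-↭ k y (Perm.prep x p))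
  Z-↭ w-↭ k (Perm.trans p q)         = ≈-trans (Z-↭ w-↭ k p) (Z-↭ w-↭ k q)

  Z-↭-prep {w} w-↭ zero    x {xs} {ys} p = ≈-trans (Z-∷ w x xs 0) (≈-sym (Z-∷ w x ys 0))
  Z-↭-prep {w} w-↭ (suc k) x {xs} {ys} p =
    ≈-trans (Z-∷ w x xs (suc k))
   (≈-trans (sumL-splits-↭ p (λ T R → w (x ∷ T) * Z w R k) (λ t r → *-cong (w-↭ (Perm.prep x t)) (Z-↭ w-↭ k r)))
            (≈-sym (Z-∷ w x ys (suc k))))

  sumL-splits-inside : ∀ (P : ℕ → Bool) {Q : ℕ → Set} {vs} → All Q vs → (G : List ℕ → List ℕ → List ℕ → Carrier) →
    (∀ T X Y → All Q T → all P T ≡ false → G T X Y ≈ 0#) →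
    sumL (λ p → G (proj₁ p) (filterᵇ P (proj₂ p)) (filterᵇ (not ∘ P) (proj₂ p))) (splits vs)
    ≈ sumL (λ p → G (proj₁ p) (proj₂ p) (filterᵇ (not ∘ P) vs)) (splits (filterᵇ P vs))
  sumL-splits-inside P []             G G-outside = ≈-refl
  sumL-splits-inside P {vs = v ∷ vs} (qv ∷ a) G G-outside with P v in v∈P
  ... | true = begin
        sumL (uncurry g) (splits (v ∷ vs))
      ≈⟨ sumL-splits-∷ g v vs ⟩
        sumL (λ p → g (v ∷ proj₁ p) (proj₂ p)) (splits vs) + sumL (λ p → g (proj₁ p) (v ∷ proj₂ p)) (splits vs)
      ≈⟨ +-cong (sumL-splits-inside P a (λ T → G (v ∷ T))
                   (λ T X Y qT T⊈P → G-outside (v ∷ T) X Y (qv ∷ qT) (Eq.trans (cong (_∧ all P T) v∈P) T⊈P)))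
                (≈-trans (sumL-cong (splits vs) (λ p → ≡⇒≈ (cong₂ (G (proj₁ p)) (filterᵇ-accept P (proj₂ p) v∈P)
                                                                               (filterᵇ-reject (not ∘ P) (proj₂ p) (cong not v∈P)))))
                         (sumL-splits-inside P a (λ T X Y → G T (v ∷ X) Y) (λ T X Y → G-outside T (v ∷ X) Y))) ⟩
        sumL (λ p → h (v ∷ proj₁ p) (proj₂ p)) (splits (filterᵇ P vs))
          + sumL (λ p → h (proj₁ p) (v ∷ proj₂ p)) (splits (filterᵇ P vs))
      ≈⟨ ≈-sym (sumL-splits-∷ h v (filterᵇ P vs)) ⟩
        sumL (uncurry h) (splits (v ∷ filterᵇ P vs))
      ∎
    where
    g h : List ℕ → List ℕ → Carrier
    g T R = G T (filterᵇ P R) (filterᵇ (not ∘ P) R)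
    h T X = G T X (filterᵇ (not ∘ P) vs)
  ... | false = begin
        sumL (uncurry g) (splits (v ∷ vs))
      ≈⟨ sumL-splits-∷ g v vs ⟩
        sumL (λ p → g (v ∷ proj₁ p) (proj₂ p)) (splits vs) + sumL (λ p → g (proj₁ p) (v ∷ proj₂ p)) (splits vs)
      ≈⟨ +-cong (≈-trans (sumL-congᴬ (splits-All a) (λ p qp → G-outside (v ∷ proj₁ p) _ _ (qv ∷ proj₁ qp) (cong (_∧ all P (proj₁ p)) v∈P)))
                         (sumL-zero (splits vs) (λ _ → ≈-refl)))
                (≈-trans (sumL-cong (splits vs) (λ p → ≡⇒≈ (cong₂ (G (proj₁ p)) (filterᵇ-reject P (proj₂ p) v∈P)
                                                                               (filterᵇ-accept (not ∘ P) (proj₂ p) (cong not v∈P)))))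
                         (sumL-splits-inside P a (λ T X Y → G T X (v ∷ Y)) (λ T X Y → G-outside T X (v ∷ Y)))) ⟩
        0# + sumL (λ p → G (proj₁ p) (proj₂ p) (v ∷ filterᵇ (not ∘ P) vs)) (splits (filterᵇ P vs))
      ≈⟨ +-identityˡ _ ⟩
        sumL (λ p → G (proj₁ p) (proj₂ p) (v ∷ filterᵇ (not ∘ P) vs)) (splits (filterᵇ P vs))
      ∎
    where
    g : List ℕ → List ℕ → Carrier
    g T R = G T (filterᵇ P R) (filterᵇ (not ∘ P) R)

  MixedZero : (ℕ → Bool) → (ℕ → Set) → (List ℕ → Carrier) → Set ℓ
  MixedZero P Q w = ∀ B → All Q B → all P B ≡ false → all (not ∘ P) B ≡ false → w B ≈ 0#

  MixedZero-not : ∀ {P Q w} → MixedZero P Q w → MixedZero (not ∘ P) Q w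
  MixedZero-not {P} mixed B qB B⊈¬P B⊈P = mixed B qB (Eq.trans (Eq.sym (all-not-not P B)) B⊈P) B⊈¬P

  -- If w vanishes on mixed blocks, the contributing partitions of L are
  -- exactly the unions of a partition of L ∩ P and one of L \ P, hence
  --   Z w L = Z w (L ∩ P) · Z w (L \ P).
  -- The head entry of L is moved into P by swapping P and its complement.
  Z-multiplicative : ∀ {Q w} k (P : ℕ → Bool) → MixedZero P Q w → ∀ L → All Q L →
    Z w L k ≈ cv (Z w (filterᵇ P L)) (Z w (filterᵇ (not ∘ P) L)) k
  Z-headInside : ∀ {Q w} k (P : ℕ → Bool) → MixedZero P Q w → ∀ v vs → All Q (v ∷ vs) → P v ≡ true →
    Z w (v ∷ vs) k ≈ cv (Z w (v ∷ filterᵇ P vs)) (Z w (filterᵇ (not ∘ P) vs)) k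

  Z-multiplicative {w = w} k P mixed []       a = ≈-sym (cv-identityˡ _ _ (Z-[] w) k)
  Z-multiplicative {w = w} k P mixed (v ∷ vs) a with P v in v∈P
  ... | true  = Z-headInside k P mixed v vs a v∈P
  ... | false = begin
      Z w (v ∷ vs) k
    ≈⟨ Z-headInside k (not ∘ P) (MixedZero-not mixed) v vs a (cong not v∈P) ⟩
      cv (Z w (v ∷ filterᵇ (not ∘ P) vs)) (Z w (filterᵇ (not ∘ not ∘ P) vs)) k
    ≈⟨ ≡⇒≈ (cong (λ L → cv (Z w (v ∷ filterᵇ (not ∘ P) vs)) (Z w L) k) (filterᵇ-not-not P vs)) ⟩
      cv (Z w (v ∷ filterᵇ (not ∘ P) vs)) (Z w (filterᵇ P vs)) k
    ≈⟨ cv-comm _ _ k ⟩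
      cv (Z w (filterᵇ P vs)) (Z w (v ∷ filterᵇ (not ∘ P) vs)) k
    ∎

  Z-headInside {w = w} zero    P mixed v vs a v∈P =
    ≈-trans (Z-∷ w v vs 0) (≈-sym (≈-trans (*-cong (Z-∷ w v (filterᵇ P vs) 0) ≈-refl) (zeroˡ _)))
  Z-headInside {Q} {w} (suc k) P mixed v vs (qv ∷ a) v∈P = begin
      Z w (v ∷ vs) (suc k)
    ≈⟨ Z-∷ w v vs (suc k) ⟩
      headSum w v vs k
    ≈⟨ sumL-congᴬ (splits-All a) (λ p qp → *-cong ≈-refl (Z-multiplicative k P mixed (proj₂ p) (proj₂ qp))) ⟩
      sumL (λ p → G (proj₁ p) (filterᵇ P (proj₂ p)) (filterᵇ (not ∘ P) (proj₂ p))) (splits vs)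
    ≈⟨ sumL-splits-inside P a G G-outside ⟩
      sumL (λ p → w (v ∷ proj₁ p) * cv (Z w (proj₂ p)) Z₂ k) (splits (filterᵇ P vs))
    ≈⟨ sumL-cong (splits (filterᵇ P vs)) (λ p → ≈-sym (cv-*ˡ (w (v ∷ proj₁ p)) (Z w (proj₂ p)) Z₂ k)) ⟩
      sumL (λ p → cv (λ i → w (v ∷ proj₁ p) * Z w (proj₂ p) i) Z₂ k) (splits (filterᵇ P vs))
    ≈⟨ ≈-sym (cv-sumˡ (λ p i → w (v ∷ proj₁ p) * Z w (proj₂ p) i) (splits (filterᵇ P vs)) Z₂ k) ⟩
      cv (headSum w v (filterᵇ P vs)) Z₂ k
    ≈⟨ ≈-sym (cv-shiftˡ _ Z₂ (suc k)) ⟩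
      cv (shift (headSum w v (filterᵇ P vs))) Z₂ (suc k)
    ≈⟨ ≈-sym (cv-cong (Z-∷ w v (filterᵇ P vs)) (λ _ → ≈-refl) (suc k)) ⟩
      cv (Z w (v ∷ filterᵇ P vs)) Z₂ (suc k)
    ∎
    where
    Z₂ : ℕ → Carrier
    Z₂ = Z w (filterᵇ (not ∘ P) vs)
    G : List ℕ → List ℕ → List ℕ → Carrier
    G T X Y = w (v ∷ T) * cv (Z w X) (Z w Y) k
    -- the block v ∷ T is mixed as soon as T leaves P
    G-outside : ∀ T X Y → All Q T → all P T ≡ false → G T X Y ≈ 0#
    G-outside T X Y qT T⊈P = ≈-trans (*-cong (mixed (v ∷ T) (qv ∷ qT) (Eq.trans (cong (_∧ all P T) v∈P) T⊈P)
                                                                      (cong (λ b → not b ∧ all (not ∘ P) T) v∈P)) ≈-refl)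
                                     (zeroˡ _)

  -- A split of vs is a split of vs ∩ P together with an independent split
  -- of vs \ P; hence a sum over splits of products of a P-part and a
  -- (not P)-part is the product of the two sums.
  sumL-splits-product : ∀ (P : ℕ → Bool) vs (F H : List ℕ → List ℕ → ℕ → Carrier) j →
    sumL (λ p → cv (F (filterᵇ P (proj₁ p)) (filterᵇ P (proj₂ p)))
                   (H (filterᵇ (not ∘ P) (proj₁ p)) (filterᵇ (not ∘ P) (proj₂ p))) j) (splits vs)
    ≈ cv (λ i → sumL (λ p → F (proj₁ p) (proj₂ p) i) (splits (filterᵇ P vs)))
         (λ i → sumL (λ p → H (proj₁ p) (proj₂ p) i) (splits (filterᵇ (not ∘ P) vs))) j
  sumL-splits-product-head : ∀ (P : ℕ → Bool) v vs (F H : List ℕ → List ℕ → ℕ → Carrier) j → P v ≡ true →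
    sumL (λ p → cv (F (filterᵇ P (proj₁ p)) (filterᵇ P (proj₂ p)))
                   (H (filterᵇ (not ∘ P) (proj₁ p)) (filterᵇ (not ∘ P) (proj₂ p))) j) (splits (v ∷ vs))
    ≈ cv (λ i → sumL (λ p → F (proj₁ p) (proj₂ p) i) (splits (v ∷ filterᵇ P vs)))
         (λ i → sumL (λ p → H (proj₁ p) (proj₂ p) i) (splits (filterᵇ (not ∘ P) vs))) j

  sumL-splits-product P []       F H j =
    ≈-trans (+-identityʳ _) (cv-cong (λ i → ≈-sym (+-identityʳ _)) (λ i → ≈-sym (+-identityʳ _)) j)
  sumL-splits-product P (v ∷ vs) F H j with P v in v∈P
  ... | true  = sumL-splits-product-head P v vs F H j v∈P
  ... | false = begin
      sumL (λ p → cv (F (filterᵇ P (proj₁ p)) (filterᵇ P (proj₂ p)))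
                     (H (filterᵇ (not ∘ P) (proj₁ p)) (filterᵇ (not ∘ P) (proj₂ p))) j) (splits (v ∷ vs))
    ≈⟨ sumL-cong (splits (v ∷ vs)) (λ p → ≈-trans (cv-comm _ _ j) (≡⇒≈ (cong₂ (λ X Y → cv (H (filterᵇ (not ∘ P) (proj₁ p)) (filterᵇ (not ∘ P) (proj₂ p))) (F X Y) j)
                                          (Eq.sym (filterᵇ-not-not P (proj₁ p))) (Eq.sym (filterᵇ-not-not P (proj₂ p)))))) ⟩
      sumL (λ p → cv (H (filterᵇ (not ∘ P) (proj₁ p)) (filterᵇ (not ∘ P) (proj₂ p)))
                     (F (filterᵇ (not ∘ not ∘ P) (proj₁ p)) (filterᵇ (not ∘ not ∘ P) (proj₂ p))) j) (splits (v ∷ vs))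
    ≈⟨ sumL-splits-product-head (not ∘ P) v vs H F j (cong not v∈P) ⟩
      cv (λ i → sumL (λ p → H (proj₁ p) (proj₂ p) i) (splits (v ∷ filterᵇ (not ∘ P) vs)))
         (λ i → sumL (λ p → F (proj₁ p) (proj₂ p) i) (splits (filterᵇ (not ∘ not ∘ P) vs))) j
    ≈⟨ ≈-trans (cv-comm _ _ j) (≡⇒≈ (cong (λ L → cv (λ i → sumL (λ p → F (proj₁ p) (proj₂ p) i) (splits L))
                                                  (λ i → sumL (λ p → H (proj₁ p) (proj₂ p) i) (splits (v ∷ filterᵇ (not ∘ P) vs))) j)
                                             (filterᵇ-not-not P vs))) ⟩
      cv (λ i → sumL (λ p → F (proj₁ p) (proj₂ p) i) (splits (filterᵇ P vs)))
         (λ i → sumL (λ p → H (proj₁ p) (proj₂ p) i) (splits (v ∷ filterᵇ (not ∘ P) vs))) j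
    ∎

  sumL-splits-product-head P v vs F H j v∈P = begin
      sumL (uncurry g) (splits (v ∷ vs))
    ≈⟨ sumL-splits-∷ g v vs ⟩
      sumL (λ p → g (v ∷ proj₁ p) (proj₂ p)) (splits vs) + sumL (λ p → g (proj₁ p) (v ∷ proj₂ p)) (splits vs)
    ≈⟨ +-cong (≈-trans (sumL-cong (splits vs) (λ p → ≡⇒≈ (cong₂ (λ X X' → cv (F X (filterᵇ P (proj₂ p))) (H X' (filterᵇ (not ∘ P) (proj₂ p))) j)
                                                        (filterᵇ-accept P (proj₁ p) v∈P) (filterᵇ-reject (not ∘ P) (proj₁ p) (cong not v∈P)))))
                       (sumL-splits-product P vs (λ X Y → F (v ∷ X) Y) H j))
              (≈-trans (sumL-cong (splits vs) (λ p → ≡⇒≈ (cong₂ (λ Y Y' → cv (F (filterᵇ P (proj₁ p)) Y) (H (filterᵇ (not ∘ P) (proj₁ p)) Y') j)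
                                                        (filterᵇ-accept P (proj₂ p) v∈P) (filterᵇ-reject (not ∘ P) (proj₂ p) (cong not v∈P)))))
                       (sumL-splits-product P vs (λ X Y → F X (v ∷ Y)) H j)) ⟩
      cv F₁ Hs j + cv F₂ Hs j
    ≈⟨ ≈-sym (cv-+ˡ F₁ F₂ Hs j) ⟩
      cv (λ i → F₁ i + F₂ i) Hs j
    ≈⟨ cv-cong (λ i → ≈-sym (sumL-splits-∷ (λ X Y → F X Y i) v (filterᵇ P vs))) (λ _ → ≈-refl) j ⟩
      cv (λ i → sumL (λ p → F (proj₁ p) (proj₂ p) i) (splits (v ∷ filterᵇ P vs))) Hs j
    ∎
    where
    g : List ℕ → List ℕ → Carrier
    g X Y = cv (F (filterᵇ P X) (filterᵇ P Y)) (H (filterᵇ (not ∘ P) X) (filterᵇ (not ∘ P) Y)) j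
    F₁ F₂ Hs : ℕ → Carrier
    F₁ i = sumL (λ p → F (v ∷ proj₁ p) (proj₂ p) i) (splits (filterᵇ P vs))
    F₂ i = sumL (λ p → F (proj₁ p) (v ∷ proj₂ p) i) (splits (filterᵇ P vs))
    Hs i = sumL (λ p → H (proj₁ p) (proj₂ p) i) (splits (filterᵇ (not ∘ P) vs))

  Z-gluing : ∀ {Q w} (P : ℕ → Bool) c vs → All Q vs → MixedZero P Q w →
    (∀ T → All Q T → w (c ∷ T) ≈ w (c ∷ filterᵇ P T) * w (c ∷ filterᵇ (not ∘ P) T)) →
    shift (Z w (c ∷ vs)) ≐ cv (Z w (c ∷ filterᵇ P vs)) (Z w (c ∷ filterᵇ (not ∘ P) vs))
  Z-gluing {Q} {w} P c vs a mixed w-glue k = begin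
      shift (Z w (c ∷ vs)) k
    ≈⟨ shift-cong (Z-∷ w c vs) k ⟩
      shift (shift (headSum w c vs)) k
    ≈⟨ shift-cong (shift-cong headSum-factors) k ⟩
      shift (shift (cv H₁ H₂)) k
    ≈⟨ ≈-sym (≈-trans (cv-shiftˡ H₁ (shift H₂) k) (shift-cong (cv-shiftʳ H₁ H₂) k)) ⟩
      cv (shift H₁) (shift H₂) k
    ≈⟨ ≈-sym (cv-cong (Z-∷ w c (filterᵇ P vs)) (Z-∷ w c (filterᵇ (not ∘ P) vs)) k) ⟩
      cv (Z w (c ∷ filterᵇ P vs)) (Z w (c ∷ filterᵇ (not ∘ P) vs)) k
    ∎
    where
    H₁ H₂ : ℕ → Carrier
    H₁ = headSum w c (filterᵇ P vs)
    H₂ = headSum w c (filterᵇ (not ∘ P) vs)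
    F : List ℕ → List ℕ → ℕ → Carrier
    F X Y i = w (c ∷ X) * Z w Y i
    cv-*-* : ∀ a b p q j → (a * b) * cv p q j ≈ cv (λ i → a * p i) (λ i → b * q i) j
    cv-*-* a b p q j = ≈-sym (≈-trans (cv-*ˡ a p _ j) (≈-trans (*-cong ≈-refl (cv-*ʳ b p q j)) (≈-sym (*-assoc _ _ _))))
    headSum-factors : headSum w c vs ≐ cv H₁ H₂
    headSum-factors j = begin
        sumL (λ p → w (c ∷ proj₁ p) * Z w (proj₂ p) j) (splits vs)
      ≈⟨ sumL-congᴬ (splits-All a) (λ p qp → *-cong (w-glue (proj₁ p) (proj₁ qp))
                                                     (Z-multiplicative j P mixed (proj₂ p) (proj₂ qp))) ⟩
        sumL (λ p → (w (c ∷ filterᵇ P (proj₁ p)) * w (c ∷ filterᵇ (not ∘ P) (proj₁ p)))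
                    * cv (Z w (filterᵇ P (proj₂ p))) (Z w (filterᵇ (not ∘ P) (proj₂ p))) j) (splits vs)
      ≈⟨ sumL-cong (splits vs) (λ p → cv-*-* _ _ _ _ j) ⟩
        sumL (λ p → cv (F (filterᵇ P (proj₁ p)) (filterᵇ P (proj₂ p)))
                       (F (filterᵇ (not ∘ P) (proj₁ p)) (filterᵇ (not ∘ P) (proj₂ p))) j) (splits vs)
      ≈⟨ sumL-splits-product P vs F F j ⟩
        cv H₁ H₂ j
      ∎

  -- a partition into one block is the whole list: Z w (v ∷ vs) 1 = w (v ∷ vs)
  Z-one-block : ∀ w v vs → Z w (v ∷ vs) 1 ≈ w (v ∷ vs)
  Z-one-block w v vs = ≈-trans (Z-∷ w v vs 1) (onlyEmptyRest vs (λ T → w (v ∷ T)))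
    where
    onlyEmptyRest : ∀ vs (f : List ℕ → Carrier) → sumL (λ p → f (proj₁ p) * Z w (proj₂ p) 0) (splits vs) ≈ f vs
    onlyEmptyRest []       f = ≈-trans (+-identityʳ _) (≈-trans (*-cong ≈-refl (proj₁ (Z-[] w))) (*-identityʳ _))
    onlyEmptyRest (u ∷ us) f = ≈-trans (sumL-splits-∷ (λ T R → f T * Z w R 0) u us)
      (≈-trans (+-cong (onlyEmptyRest us (λ T → f (u ∷ T)))
                       (sumL-zero (splits us) (λ p → ≈-trans (*-cong ≈-refl (Z-∷ w u (proj₂ p) 0)) (zeroʳ _))))
               (+-identityʳ _))

  coeff≈Z : ∀ b G k → coeff b G k ≈ Z (λ B → b (induced G B)) (verts G) k
  coeff≈Z b G k = selectLength (partitions (verts G))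
    where
    g : List (List ℕ) → Carrier
    g = blockProduct (λ B → b (induced G B))
    selectLength : ∀ Ps → Σᴿ (map g (filter (λ P → length P ℕ.≟ k) Ps)) ≈ sumL (λ P → δ k (length P) * g P) Ps
    selectLength []       = ≈-refl
    selectLength (P ∷ Ps) with length P ≡ᵇ k
    ... | true  = +-cong (≈-sym (*-identityˡ _)) (selectLength Ps)
    ... | false = ≈-trans (selectLength Ps) (≈-trans (≈-sym (+-identityˡ _)) (+-cong (≈-sym (zeroˡ _)) ≈-refl))

verts-All : ∀ G → All (λ v → V G v ≡ true) (verts G)
verts-All G = filterᵇ-All (V G) (upTo (bound G))

verts-unique : ∀ G → Unique (verts G)
verts-unique G = filter⁺ (T? ∘ V G) (upTo⁺ (bound G))

∈ᵇ-verts : ∀ G v → v ∈ᵇ verts G ≡ V G v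
∈ᵇ-verts G v with V G v in v∈G
... | true  = Eq.trans (∈ᵇ-filterᵇ (V G) v (upTo (bound G)))
                      (Eq.trans (cong (_∧ (v ∈ᵇ upTo (bound G))) v∈G) (∈ᵇ-upTo v (bound G) (bounded G v v∈G)))
... | false = Eq.trans (∈ᵇ-filterᵇ (V G) v (upTo (bound G))) (cong (_∧ (v ∈ᵇ upTo (bound G))) v∈G)

filterᵇ-upTo : ∀ (A : ℕ → Bool) m → (∀ x → A x ≡ true → x < m) → ∀ n → m ≤ n → filterᵇ A (upTo n) ≡ filterᵇ A (upTo m)
filterᵇ-upTo A m bnd n m≤n with m≤n⇒m<n∨m≡n m≤n
... | inj₂ refl = refl
filterᵇ-upTo A m bnd (suc n) m≤n | inj₁ m<1+n =
  Eq.trans (cong (filterᵇ A) (Eq.sym (upTo-∷ʳ n)))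
  (Eq.trans (filter-++ (T? ∘ A) (upTo n) [ n ])
  (Eq.trans (cong (filterᵇ A (upTo n) ++_) (filterᵇ-reject A [] n∉A))
  (Eq.trans (++-identityʳ _) (filterᵇ-upTo A m bnd n (≤-pred m<1+n)))))
  where
  n∉A : A n ≡ false
  n∉A with A n in e
  ... | false = refl
  ... | true  = ⊥-elim (<-irrefl refl (≤-trans (bnd n e) (≤-pred m<1+n)))

filterᵇ-verts : ∀ G G₁ → (∀ v → V G₁ v ≡ true → V G v ≡ true) → filterᵇ (V G₁) (verts G) ≡ verts G₁
filterᵇ-verts G G₁ G₁⊆G =
  Eq.trans (filterᵇ-filterᵇ (V G₁) (V G) (upTo (bound G)))
  (Eq.trans (filterᵇ-cong inG₁ (upTo (bound G)))
  (sameBound (≤-total (bound G) (bound G₁))))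
  where
  inG₁ : ∀ x → V G x ∧ V G₁ x ≡ V G₁ x
  inG₁ x with V G₁ x in x∈G₁
  ... | true  rewrite G₁⊆G x x∈G₁ = refl
  ... | false = ∧-zeroʳ _
  bounded₁ : ∀ x → V G₁ x ≡ true → x < bound G
  bounded₁ x x∈G₁ = bounded G x (G₁⊆G x x∈G₁)
  sameBound : bound G ≤ bound G₁ ⊎ bound G₁ ≤ bound G → filterᵇ (V G₁) (upTo (bound G)) ≡ verts G₁
  sameBound (inj₁ le) = Eq.sym (filterᵇ-upTo (V G₁) (bound G) bounded₁ (bound G₁) le)
  sameBound (inj₂ le) = filterᵇ-upTo (V G₁) (bound G₁) (bounded G₁) (bound G) le

verts-nonEmpty : ∀ G → NonEmpty G → Σ ℕ λ v → Σ (List ℕ) λ vs → verts G ≡ v ∷ vs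
verts-nonEmpty G (x , x∈G) with verts G in e
... | []     = ⊥-elim (true≢false (Eq.trans (Eq.sym x∈G) (Eq.trans (Eq.sym (∈ᵇ-verts G x)) (cong (x ∈ᵇ_) e))))
... | v ∷ vs = v , vs , refl

induced-verts : ∀ G → induced G (verts G) ≈ᴳ G
induced-verts G = (λ v → Eq.trans (cong (V G v ∧_) (∈ᵇ-verts G v)) (∧-idem (V G v))) , (λ u v _ _ → refl)

induced-↭ : ∀ G {B B'} → B ↭ B' → induced G B ≈ᴳ induced G B'
induced-↭ G B↭B' = (λ v → cong (V G v ∧_) (∈ᵇ-↭ B↭B' v)) , (λ u v _ _ → refl)

isUnion-sym : ∀ {G G₁ G₂} → IsUnion G G₁ G₂ → IsUnion G G₂ G₁
isUnion-sym {G} {G₁} {G₂} (sameV , sameE) =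
  (λ v → Eq.trans (sameV v) (∨-comm (V G₁ v) (V G₂ v))) ,
  (λ u v u∈G v∈G → Eq.trans (sameE u v u∈G v∈G) (∨-comm (V G₁ u ∧ V G₁ v ∧ E G₁ u v) (V G₂ u ∧ V G₂ v ∧ E G₂ u v)))

union-⊆ : ∀ {G G₁ G₂} → IsUnion G G₁ G₂ → ∀ v → V G₁ v ≡ true → V G v ≡ true
union-⊆ {G} {G₁} {G₂} (sameV , _) v v∈G₁ rewrite sameV v | v∈G₁ = refl

AtMostOneCommon : Graph → Graph → Set
AtMostOneCommon G₁ G₂ = ∀ u v → V G₁ u ≡ true → V G₂ u ≡ true → V G₁ v ≡ true → V G₂ v ≡ true → u ≡ v

atMostOne-sym : ∀ {G₁ G₂} → AtMostOneCommon G₁ G₂ → AtMostOneCommon G₂ G₁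
atMostOne-sym atMostOne u v u∈G₂ u∈G₁ v∈G₂ v∈G₁ = atMostOne u v u∈G₁ u∈G₂ v∈G₁ v∈G₂

edge-side : ∀ a₁ b₁ e₁ a₂ b₂ e₂ → (a₁ ∧ b₁ ∧ e₁) ∨ (a₂ ∧ b₂ ∧ e₂) ≡ true →
            (a₁ ≡ true × b₁ ≡ true) ⊎ (a₂ ≡ true × b₂ ≡ true)
edge-side true  true  true  a₂ b₂ e₂ _ = inj₁ (refl , refl)
edge-side true  true  false true true e₂ _ = inj₂ (refl , refl)
edge-side true  false e₁    true true e₂ _ = inj₂ (refl , refl)
edge-side false b₁    e₁    true true e₂ _ = inj₂ (refl , refl)
edge-side true  true  false true  false e₂ ()
edge-side true  true  false false b₂    e₂ ()
edge-side true  false e₁    true  false e₂ ()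
edge-side true  false e₁    false b₂    e₂ ()
edge-side false b₁    e₁    true  false e₂ ()
edge-side false b₁    e₁    false b₂    e₂ ()

edge-restrict : ∀ e x y x' y' → (e ≡ true → (x ≡ true × y ≡ true) ⊎ (x' ≡ true × y' ≡ true)) →
                e ≡ (x ∧ y ∧ e) ∨ (x' ∧ y' ∧ e)
edge-restrict false x y x' y' _ rewrite ∧-zeroʳ y | ∧-zeroʳ x | ∧-zeroʳ y' | ∧-zeroʳ x' = refl
edge-restrict true  x y x' y' ends with ends refl
... | inj₁ (refl , refl) = refl
... | inj₂ (refl , refl) = Eq.sym (∨-zeroʳ _)

∨-absorb : ∀ e a b f → (a ≡ true → b ≡ true → f ≡ false) → e ∨ (a ∧ b ∧ f) ≡ e
∨-absorb e false b     f _     = ∨-identityʳ e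
∨-absorb e true  false f _     = ∨-identityʳ e
∨-absorb e true  true  f f≡0 rewrite f≡0 refl refl = ∨-identityʳ e

-- On a block of vertices of G₁, the union G and G₁ induce the same graph
-- (G₂ contributes no edge there, as it meets G₁ in at most one vertex).
induced-side : ∀ {G G₁ G₂} → IsUnion G G₁ G₂ → AtMostOneCommon G₁ G₂ →
               ∀ B → All (λ x → V G₁ x ≡ true) B → induced G B ≈ᴳ induced G₁ B
induced-side {G} {G₁} {G₂} union atMostOne B B⊆G₁ = sameV , sameE
  where
  sameV : ∀ v → V G v ∧ (v ∈ᵇ B) ≡ V G₁ v ∧ (v ∈ᵇ B)
  sameV v with v ∈ᵇ B in v∈B
  ... | true  rewrite union-⊆ {G} {G₁} {G₂} union v (All-∈ᵇ B⊆G₁ v v∈B) | All-∈ᵇ B⊆G₁ v v∈B = refl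
  ... | false = Eq.trans (∧-zeroʳ _) (Eq.sym (∧-zeroʳ _))
  noLoop : ∀ u v → V G₁ u ≡ true → V G₁ v ≡ true → V G₂ u ≡ true → V G₂ v ≡ true → E G₂ u v ≡ false
  noLoop u v u∈G₁ v∈G₁ u∈G₂ v∈G₂ rewrite atMostOne u v u∈G₁ u∈G₂ v∈G₁ v∈G₂ = irr G₂ v
  sameE : ∀ u v → V G u ∧ (u ∈ᵇ B) ≡ true → V G v ∧ (v ∈ᵇ B) ≡ true → E G u v ≡ E G₁ u v
  sameE u v u∈ v∈ =
    Eq.trans (proj₂ union u v (∧-true-left _ _ u∈) (∧-true-left _ _ v∈))
    (Eq.trans (cong₂ (λ a b → (a ∧ b ∧ E G₁ u v) ∨ (V G₂ u ∧ V G₂ v ∧ E G₂ u v)) u∈G₁ v∈G₁)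
              (∨-absorb (E G₁ u v) (V G₂ u) (V G₂ v) (E G₂ u v) (noLoop u v u∈G₁ v∈G₁)))
    where
    u∈G₁ = All-∈ᵇ B⊆G₁ u (∧-true-right _ _ u∈)
    v∈G₁ = All-∈ᵇ B⊆G₁ v (∧-true-right _ _ v∈)

split-∨ : ∀ a e p m → a ∧ (e ∨ m) ≡ (a ∧ (e ∨ (p ∧ m))) ∨ (a ∧ (e ∨ (not p ∧ m)))
split-∨ false e     p     m = refl
split-∨ true  true  p     m = refl
split-∨ true  false true  m = Eq.sym (∨-identityʳ m)
split-∨ true  false false m = refl

split-common : ∀ a e p m → a ∧ (e ∨ (p ∧ m)) ≡ true → a ∧ (e ∨ (not p ∧ m)) ≡ true → e ≡ true
split-common true true  p     m _  _  = refl
split-common true false true  m _  ()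
split-common true false false m () _

induced-glue : ∀ {G G₁ G₂} c → IsUnion G G₁ G₂ → V G₁ c ≡ true → (∀ u → V G₁ u ≡ true → V G₂ u ≡ true → u ≡ c) →
  ∀ T → IsUnion (induced G (c ∷ T)) (induced G (c ∷ filterᵇ (V G₁) T)) (induced G (c ∷ filterᵇ (not ∘ V G₁) T))
      × OneCommon (induced G (c ∷ filterᵇ (V G₁) T)) (induced G (c ∷ filterᵇ (not ∘ V G₁) T))
induced-glue {G} {G₁} {G₂} c union c∈G₁ onlyC T = (sameV , sameE) , (c , c∈H₁ , c∈H₂ , onlyCommon)
  where
  H H₁ H₂ : Graph
  H  = induced G (c ∷ T)
  H₁ = induced G (c ∷ filterᵇ (V G₁) T)
  H₂ = induced G (c ∷ filterᵇ (not ∘ V G₁) T)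
  c∈G : V G c ≡ true
  c∈G = union-⊆ {G} {G₁} {G₂} union c c∈G₁
  eqH₁ : ∀ u → V H₁ u ≡ V G u ∧ ((u ≡ᵇ c) ∨ (V G₁ u ∧ u ∈ᵇ T))
  eqH₁ u = cong (λ t → V G u ∧ ((u ≡ᵇ c) ∨ t)) (∈ᵇ-filterᵇ (V G₁) u T)
  eqH₂ : ∀ u → V H₂ u ≡ V G u ∧ ((u ≡ᵇ c) ∨ (not (V G₁ u) ∧ u ∈ᵇ T))
  eqH₂ u = cong (λ t → V G u ∧ ((u ≡ᵇ c) ∨ t)) (∈ᵇ-filterᵇ (not ∘ V G₁) u T)
  sameV : ∀ u → V H u ≡ V H₁ u ∨ V H₂ u
  sameV u = Eq.trans (split-∨ (V G u) (u ≡ᵇ c) (V G₁ u) (u ∈ᵇ T)) (Eq.sym (cong₂ _∨_ (eqH₁ u) (eqH₂ u)))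
  c∈H₁ : V H₁ c ≡ true
  c∈H₁ rewrite c∈G | ≡ᵇ-refl c = refl
  c∈H₂ : V H₂ c ≡ true
  c∈H₂ rewrite c∈G | ≡ᵇ-refl c = refl
  onlyCommon : ∀ u → V H₁ u ≡ true → V H₂ u ≡ true → u ≡ c
  onlyCommon u u∈H₁ u∈H₂ = ≡ᵇ-true⇒≡ u c (split-common (V G u) (u ≡ᵇ c) (V G₁ u) (u ∈ᵇ T)
                             (Eq.trans (Eq.sym (eqH₁ u)) u∈H₁) (Eq.trans (Eq.sym (eqH₂ u)) u∈H₂))
  toH₁ : ∀ u → V H u ≡ true → V G₁ u ≡ true → V H₁ u ≡ true
  toH₁ u u∈H u∈G₁ = Eq.trans (eqH₁ u) (Eq.trans (cong (λ p → V G u ∧ ((u ≡ᵇ c) ∨ (p ∧ (u ∈ᵇ T)))) u∈G₁) u∈H)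
  toH₂ : ∀ u → V H u ≡ true → V G₂ u ≡ true → V H₂ u ≡ true
  toH₂ u u∈H u∈G₂ with V G₁ u in u∈G₁
  ... | true  rewrite onlyC u u∈G₁ u∈G₂ = c∈H₂
  ... | false = Eq.trans (eqH₂ u) (Eq.trans (cong (λ p → V G u ∧ ((u ≡ᵇ c) ∨ (not p ∧ (u ∈ᵇ T)))) u∈G₁) u∈H)
  sameE : ∀ u v → V H u ≡ true → V H v ≡ true → E G u v ≡ (V H₁ u ∧ V H₁ v ∧ E G u v) ∨ (V H₂ u ∧ V H₂ v ∧ E G u v)
  sameE u v u∈H v∈H = edge-restrict (E G u v) (V H₁ u) (V H₁ v) (V H₂ u) (V H₂ v) ends
    where
    ends : E G u v ≡ true → (V H₁ u ≡ true × V H₁ v ≡ true) ⊎ (V H₂ u ≡ true × V H₂ v ≡ true)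
    ends uv with edge-side (V G₁ u) (V G₁ v) (E G₁ u v) (V G₂ u) (V G₂ v) (E G₂ u v)
                   (Eq.trans (Eq.sym (proj₂ union u v (∧-true-left _ _ u∈H) (∧-true-left _ _ v∈H))) uv)
    ... | inj₁ (u∈G₁ , v∈G₁) = inj₁ (toH₁ u u∈H u∈G₁ , toH₁ v v∈H v∈G₁)
    ... | inj₂ (u∈G₂ , v∈G₂) = inj₂ (toH₂ u u∈H u∈G₂ , toH₂ v v∈H v∈G₂)

all-false : ∀ (P : ℕ → Bool) B → all P B ≡ false → Σ ℕ λ x → x ∈ᵇ B ≡ true × P x ≡ false
all-false P []       ()
all-false P (x ∷ xs) e with P x in px
... | false = x , cong (_∨ (x ∈ᵇ xs)) (≡ᵇ-refl x) , px
... | true with all-false P xs e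
...   | y , y∈xs , py = y , Eq.trans (cong ((y ≡ᵇ x) ∨_) y∈xs) (∨-zeroʳ _) , py

walk-closed : ∀ {H} (S : ℕ → Bool) →
  (∀ u v → V H u ≡ true → V H v ≡ true → S u ≡ true → E H u v ≡ true → S v ≡ true) →
  ∀ {u v} → Walk H u v → V H u ≡ true → S u ≡ true → S v ≡ true
walk-closed S closed here                    u∈H u∈S = u∈S
walk-closed S closed (step {u} {w} uw w∈H rest) u∈H u∈S = walk-closed S closed rest w∈H (closed u w u∈H w∈H u∈S uw)

-- In a union G of G₁ and G₂, a block B of vertices of G none of which is
-- shared by G₁ and G₂ (vertices satisfying Q) that meets both G₁ and its
-- complement induces a non-empty disconnected graph: no edge of G leaves
-- G₁ at an unshared vertex.
mixed-disconnected : ∀ {G G₁ G₂} → IsUnion G G₁ G₂ → ∀ {Q : ℕ → Set} →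
  (∀ u → Q u → V G u ≡ true) → (∀ u → Q u → V G₁ u ≡ true → V G₂ u ≡ false) →
  ∀ B → All Q B → all (V G₁) B ≡ false → all (not ∘ V G₁) B ≡ false →
  NonEmpty (induced G B) × ¬ Connected (induced G B)
mixed-disconnected {G} {G₁} {G₂} union {Q} Q⊆G unshared B qB B⊈G₁ B⊈¬G₁
  with all-false (V G₁) B B⊈G₁ | all-false (not ∘ V G₁) B B⊈¬G₁
... | x , x∈B , x∉G₁ | y , y∈B , y∉¬G₁ = (y , y∈H) , disconnected
  where
  H : Graph
  H = induced G B
  y∈H : V H y ≡ true
  y∈H = cong₂ _∧_ (Q⊆G y (All-∈ᵇ qB y y∈B)) y∈B
  x∈H : V H x ≡ true
  x∈H = cong₂ _∧_ (Q⊆G x (All-∈ᵇ qB x x∈B)) x∈B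
  y∈G₁ : V G₁ y ≡ true
  y∈G₁ = not-false (V G₁ y) y∉¬G₁
  closed : ∀ u v → V H u ≡ true → V H v ≡ true → V G₁ u ≡ true → E H u v ≡ true → V G₁ v ≡ true
  closed u v u∈H v∈H u∈G₁ uv
    with edge-side (V G₁ u) (V G₁ v) (E G₁ u v) (V G₂ u) (V G₂ v) (E G₂ u v)
                   (Eq.trans (Eq.sym (proj₂ union u v (∧-true-left _ _ u∈H) (∧-true-left _ _ v∈H))) uv)
  ... | inj₁ (_ , v∈G₁) = v∈G₁
  ... | inj₂ (u∈G₂ , _) = ⊥-elim (true≢false (Eq.trans (Eq.sym u∈G₂) (unshared u (All-∈ᵇ qB u (∧-true-right _ _ u∈H)) u∈G₁)))
  disconnected : ¬ Connected H
  disconnected connected = true≢false (Eq.trans (Eq.sym (walk-closed (V G₁) closed (connected y x y∈H x∈H) y∈H y∈G₁)) x∉G₁)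

any-true : ∀ (p : ℕ → Bool) xs → any p xs ≡ true → Σ ℕ λ w → p w ≡ true
any-true p []       ()
any-true p (x ∷ xs) e with ∨-true (p x) (any p xs) e
... | inj₁ px = x , px
... | inj₂ rest = any-true p xs rest

any-∈ : ∀ (p : ℕ → Bool) u xs → u ∈ᵇ xs ≡ true → p u ≡ true → any p xs ≡ true
any-∈ p u []       ()   pu
any-∈ p u (x ∷ xs) u∈ pu with ∨-true (u ≡ᵇ x) (u ∈ᵇ xs) u∈
... | inj₁ u≡x rewrite Eq.sym (≡ᵇ-true⇒≡ u x u≡x) | pu = refl
... | inj₂ u∈xs rewrite any-∈ p u xs u∈xs pu = ∨-zeroʳ _

length-filterᵇ-mono : ∀ (P P' : ℕ → Bool) → (∀ x → P x ≡ true → P' x ≡ true) → ∀ xs →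
  length (filterᵇ P xs) ≤ length (filterᵇ P' xs)
length-filterᵇ-mono P P' P⊆P' []       = z≤n
length-filterᵇ-mono P P' P⊆P' (x ∷ xs) with P x in px | P' x in p'x
... | true  | true  = s≤s (length-filterᵇ-mono P P' P⊆P' xs)
... | true  | false = ⊥-elim (true≢false (Eq.trans (Eq.sym (P⊆P' x px)) p'x))
... | false | true  = m≤n⇒m≤1+n (length-filterᵇ-mono P P' P⊆P' xs)
... | false | false = length-filterᵇ-mono P P' P⊆P' xs

length-filterᵇ-grow : ∀ (P P' : ℕ → Bool) → (∀ x → P x ≡ true → P' x ≡ true) → ∀ v xs →
  v ∈ᵇ xs ≡ true → P v ≡ false → P' v ≡ true → suc (length (filterᵇ P xs)) ≤ length (filterᵇ P' xs)
length-filterᵇ-grow P P' P⊆P' v []       ()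
length-filterᵇ-grow P P' P⊆P' v (x ∷ xs) v∈ pv p'v with v ≡ᵇ x in v≡x
... | true with ≡ᵇ-true⇒≡ v x v≡x
...   | refl rewrite pv | p'v = s≤s (length-filterᵇ-mono P P' P⊆P' xs)
length-filterᵇ-grow P P' P⊆P' v (x ∷ xs) v∈ pv p'v | false with P x in px | P' x in p'x
... | true  | true  = s≤s (length-filterᵇ-grow P P' P⊆P' v xs v∈ pv p'v)
... | true  | false = ⊥-elim (true≢false (Eq.trans (Eq.sym (P⊆P' x px)) p'x))
... | false | true  = m≤n⇒m≤1+n (length-filterᵇ-grow P P' P⊆P' v xs v∈ pv p'v)
... | false | false = length-filterᵇ-grow P P' P⊆P' v xs v∈ pv p'v

walk-snoc : ∀ {H u w v} → Walk H u w → E H w v ≡ true → V H v ≡ true → Walk H u v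
walk-snoc here              wv v∈H = step wv v∈H here
walk-snoc (step uw w∈H rest) wv v∈H = step uw w∈H (walk-snoc rest wv v∈H)

walk-++ : ∀ {H u w v} → Walk H u w → Walk H w v → Walk H u v
walk-++ here              q = q
walk-++ (step uw w∈H rest) q = step uw w∈H (walk-++ rest q)

walk-reverse : ∀ {H u v} → V H u ≡ true → Walk H u v → Walk H v u
walk-reverse u∈H here = here
walk-reverse {H} u∈H (step {u} {w} uw w∈H rest) = walk-snoc (walk-reverse w∈H rest) (Eq.trans (sym H w u) uw) u∈H

-- The component of a vertex u₀, computed as the set of vertices reachable
-- in m steps for an m at which the reachable set stops growing.
module Component (H : Graph) (u₀ : ℕ) (u₀∈H : V H u₀ ≡ true) where
  N : ℕ
  N = bound H

  reach : ℕ → ℕ → Bool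
  reach zero    v = v ≡ᵇ u₀
  reach (suc n) v = reach n v ∨ (V H v ∧ any (λ w → reach n w ∧ E H w v) (upTo N))

  reach-walk : ∀ n v → reach n v ≡ true → V H v ≡ true × Walk H u₀ v
  reach-walk zero    v e with ≡ᵇ-true⇒≡ v u₀ e
  ... | refl = u₀∈H , here
  reach-walk (suc n) v e with ∨-true (reach n v) _ e
  ... | inj₁ earlier = reach-walk n v earlier
  ... | inj₂ new with any-true _ (upTo N) (∧-true-right (V H v) _ new)
  ...   | w , w→v = ∧-true-left (V H v) _ new ,
                    walk-snoc (proj₂ (reach-walk n w (∧-true-left (reach n w) _ w→v))) (∧-true-right (reach n w) _ w→v)
                              (∧-true-left (V H v) _ new)

  reach-start : ∀ n → reach n u₀ ≡ true
  reach-start zero    = ≡ᵇ-refl u₀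
  reach-start (suc n) rewrite reach-start n = refl

  reach-mono : ∀ n x → reach n x ≡ true → reach (suc n) x ≡ true
  reach-mono n x e = cong (_∨ (V H x ∧ any (λ w → reach n w ∧ E H w x) (upTo N))) e

  Stable : ℕ → Set
  Stable m = All (λ v → (not (reach (suc m) v) ∨ reach m v) ≡ true) (upTo N)

  stable-closed : ∀ m → Stable m → ∀ u v → V H u ≡ true → V H v ≡ true → reach m u ≡ true → E H u v ≡ true → reach m v ≡ true
  stable-closed m stable u v u∈H v∈H u∈R uv = noGrowth (reach (suc m) v) refl (All-∈ᵇ stable v (∈ᵇ-upTo v N (bounded H v v∈H)))
    where
    v∈R' : reach (suc m) v ≡ true
    v∈R' rewrite v∈H | any-∈ (λ w → reach m w ∧ E H w v) u (upTo N) (∈ᵇ-upTo u N (bounded H u u∈H)) (cong₂ _∧_ u∈R uv) = ∨-zeroʳ _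
    noGrowth : ∀ t → reach (suc m) v ≡ t → not t ∨ reach m v ≡ true → reach m v ≡ true
    noGrowth true  _ h = h
    noGrowth false e _ = ⊥-elim (true≢false (Eq.trans (Eq.sym v∈R') e))

  -- until it stabilises, the reachable set gains a vertex at every step
  size : ℕ → ℕ
  size n = length (filterᵇ (reach n) (upTo N))

  growth : ∀ n → Σ ℕ Stable ⊎ n ≤ size n
  growth zero    = inj₂ z≤n
  growth (suc n) with growth n
  ... | inj₁ s = inj₁ s
  ... | inj₂ n≤size with search (λ v → not (reach (suc n) v) ∨ reach n v) (upTo N)
  ...   | inj₁ stable = inj₁ (n , stable)
  ...   | inj₂ (v , v∈ , grows) = inj₂ (≤-trans (s≤s n≤size)
            (length-filterᵇ-grow (reach n) (reach (suc n)) (reach-mono n) v (upTo N) v∈ (proj₂ new) (proj₁ new)))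
    where
    new : reach (suc n) v ≡ true × reach n v ≡ false
    new = not-∨-false (reach (suc n) v) (reach n v) grows

  stabilises : Σ ℕ Stable
  stabilises with growth (suc N)
  ... | inj₁ s = s
  ... | inj₂ N<size = ⊥-elim (<-irrefl refl (≤-trans N<size (≤-trans (length-filter (T? ∘ reach (suc N)) (upTo N))
                                                                        (≤-reflexive (length-upTo N)))))

restrict : Graph → (ℕ → Bool) → Graph
restrict H S = record
  { V = λ v → V H v ∧ S v ; bound = bound H ; bounded = λ v p → bounded H v (∧-true-left (V H v) (S v) p)
  ; E = E H ; sym = sym H ; irr = irr H }

split-∧ : ∀ a s → a ≡ (a ∧ s) ∨ (a ∧ not s)
split-∧ true  true  = refl
split-∧ true  false = refl
split-∧ false s     = refl

restrict-split : ∀ H (S : ℕ → Bool) →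
  (∀ u v → V H u ≡ true → V H v ≡ true → S u ≡ true → E H u v ≡ true → S v ≡ true) →
  IsUnion H (restrict H S) (restrict H (not ∘ S)) × Disjoint (restrict H S) (restrict H (not ∘ S))
restrict-split H S closed = ((λ v → split-∧ (V H v) (S v)) , sameE) , disjoint
  where
  sameE : ∀ u v → V H u ≡ true → V H v ≡ true →
    E H u v ≡ ((V H u ∧ S u) ∧ (V H v ∧ S v) ∧ E H u v) ∨ ((V H u ∧ not (S u)) ∧ (V H v ∧ not (S v)) ∧ E H u v)
  sameE u v u∈H v∈H = edge-restrict (E H u v) _ _ _ _ ends
    where
    ends : E H u v ≡ true → ((V H u ∧ S u) ≡ true × (V H v ∧ S v) ≡ true)
                          ⊎ ((V H u ∧ not (S u)) ≡ true × (V H v ∧ not (S v)) ≡ true)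
    ends uv rewrite u∈H | v∈H with S u in u∈S | S v in v∈S
    ... | true  | true  = inj₁ (refl , refl)
    ... | false | false = inj₂ (refl , refl)
    ... | true  | false = ⊥-elim (true≢false (Eq.trans (Eq.sym (closed u v u∈H v∈H u∈S uv)) v∈S))
    ... | false | true  = ⊥-elim (true≢false (Eq.trans (Eq.sym (closed v u v∈H u∈H v∈S (Eq.trans (sym H v u) uv))) u∈S))
  disjoint : Disjoint (restrict H S) (restrict H (not ∘ S))
  disjoint v in₁ in₂ with V H v | S v
  disjoint v () in₂ | true | false
  disjoint v in₁ () | true | true
  disjoint v () in₂ | false | _

-- A non-empty disconnected graph is a disjoint union of two non-empty
-- graphs: the component of a vertex and the rest.
disconnected-split : ∀ H → NonEmpty H → ¬ Connected H →
  Σ Graph λ H₁ → Σ Graph λ H₂ → IsUnion H H₁ H₂ × Disjoint H₁ H₂ × NonEmpty H₁ × NonEmpty H₂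
disconnected-split H (u₀ , u₀∈H) disconnected with Component.stabilises H u₀ u₀∈H
... | m , stable with search (λ x → not (V H x) ∨ Component.reach H u₀ u₀∈H m x) (upTo (bound H))
...   | inj₁ covered = ⊥-elim (disconnected connected)
  where
  open Component H u₀ u₀∈H
  inComponent : ∀ u → V H u ≡ true → reach m u ≡ true
  inComponent u u∈H = Eq.trans (Eq.sym (cong (λ t → not t ∨ reach m u) u∈H)) (All-∈ᵇ covered u (∈ᵇ-upTo u N (bounded H u u∈H)))
  connected : Connected H
  connected u v u∈H v∈H = walk-++ (walk-reverse u₀∈H (proj₂ (reach-walk m u (inComponent u u∈H))))
                                  (proj₂ (reach-walk m v (inComponent v v∈H)))
...   | inj₂ (x , _ , outside) =
  restrict H C , restrict H (not ∘ C) , proj₁ split , proj₂ split ,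
  (u₀ , cong₂ _∧_ u₀∈H (reach-start m)) , (x , cong₂ _∧_ x∈H (cong not x∉C))
  where
  open Component H u₀ u₀∈H
  C : ℕ → Bool
  C = reach m
  split : IsUnion H (restrict H C) (restrict H (not ∘ C)) × Disjoint (restrict H C) (restrict H (not ∘ C))
  split = restrict-split H C (stable-closed m stable)
  x∈H : V H x ≡ true
  x∈H = proj₁ (not-∨-false (V H x) (C x) outside)
  x∉C : C x ≡ false
  x∉C = proj₂ (not-∨-false (V H x) (C x) outside)

complement-side : ∀ {G G₁ G₂} → IsUnion G G₁ G₂ → ∀ x → V G x ≡ true →
                  (V G₁ x ≡ true → V G₂ x ≡ false) → not (V G₁ x) ≡ V G₂ x
complement-side {G} {G₁} {G₂} (sameV , _) x x∈G unshared with V G₁ x in x∈G₁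
... | true  = Eq.sym (unshared refl)
... | false = Eq.trans (Eq.sym x∈G) (Eq.trans (sameV x) (cong (_∨ V G₂ x) x∈G₁))

filterᵇ-around : ∀ (P : ℕ → Bool) c pre post → P c ≡ true →
                 filterᵇ P (pre ++ c ∷ post) ↭ c ∷ filterᵇ P (pre ++ post)
filterᵇ-around P c pre post c∈P =
  subst (_↭ c ∷ filterᵇ P (pre ++ post)) (Eq.sym aroundC)
        (subst (λ L → filterᵇ P pre ++ c ∷ filterᵇ P post ↭ c ∷ L) (Eq.sym (filter-++ (T? ∘ P) pre post))
               (↭-shift c (filterᵇ P pre) (filterᵇ P post)))
  where
  aroundC : filterᵇ P (pre ++ c ∷ post) ≡ filterᵇ P pre ++ c ∷ filterᵇ P post
  aroundC = Eq.trans (filter-++ (T? ∘ P) pre (c ∷ post)) (cong (filterᵇ P pre ++_) (filterᵇ-accept P post c∈P))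

OtherVertex : Graph → ℕ → ℕ → Set
OtherVertex G c x = V G x ≡ true × (x ≡ᵇ c) ≡ false

other-unshared : ∀ {G₁ G₂ c} → (∀ u → V G₁ u ≡ true → V G₂ u ≡ true → u ≡ c) →
                 ∀ u → (u ≡ᵇ c) ≡ false → V G₁ u ≡ true → V G₂ u ≡ false
other-unshared {G₁} {G₂} onlyC u u≢c u∈G₁ with V G₂ u in u∈G₂
... | true  = ⊥-elim (true≢false (Eq.trans (Eq.sym (Eq.trans (cong (u ≡ᵇ_) (Eq.sym (onlyC u u∈G₁ u∈G₂))) (≡ᵇ-refl u))) u≢c))
... | false = refl

verts-common : ∀ {G G₁ G₂} c → IsUnion G G₁ G₂ → V G₁ c ≡ true → V G₂ c ≡ true →
  (∀ u → V G₁ u ≡ true → V G₂ u ≡ true → u ≡ c) →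
  Σ (List ℕ) λ vs → All (OtherVertex G c) vs × verts G ↭ c ∷ vs
    × verts G₁ ↭ c ∷ filterᵇ (V G₁) vs × verts G₂ ↭ c ∷ filterᵇ (not ∘ V G₁) vs
verts-common {G} {G₁} {G₂} c union c∈G₁ c∈G₂ onlyC
  with splitAt c (verts G) (verts-unique G) (Eq.trans (∈ᵇ-verts G c) (union-⊆ {G} {G₁} {G₂} union c c∈G₁))
... | pre , post , vertsG , fresh = pre ++ post , others , vertsG↭ , vertsG₁↭ , vertsG₂↭
  where
  others : All (OtherVertex G c) (pre ++ post)
  others = All.zip (++⁺ (++⁻ˡ pre inG) (All.tail (++⁻ʳ pre inG)) , fresh)
    where
    inG : All (λ x → V G x ≡ true) (pre ++ c ∷ post)
    inG = subst (All (λ x → V G x ≡ true)) vertsG (verts-All G)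
  vertsG↭ : verts G ↭ c ∷ pre ++ post
  vertsG↭ = subst (_↭ c ∷ pre ++ post) (Eq.sym vertsG) (↭-shift c pre post)
  vertsG₁↭ : verts G₁ ↭ c ∷ filterᵇ (V G₁) (pre ++ post)
  vertsG₁↭ = subst (_↭ c ∷ filterᵇ (V G₁) (pre ++ post))
                   (Eq.trans (cong (filterᵇ (V G₁)) (Eq.sym vertsG)) (filterᵇ-verts G G₁ (union-⊆ {G} {G₁} {G₂} union)))
                   (filterᵇ-around (V G₁) c pre post c∈G₁)
  sideTwo : ∀ x → OtherVertex G c x → V G₂ x ≡ not (V G₁ x)
  sideTwo x (x∈G , x≢c) = Eq.sym (complement-side {G} {G₁} {G₂} union x x∈G (other-unshared {G₁} {G₂} onlyC x x≢c))
  vertsG₂↭ : verts G₂ ↭ c ∷ filterᵇ (not ∘ V G₁) (pre ++ post)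
  vertsG₂↭ = subst₂ _↭_ (Eq.trans (cong (filterᵇ (V G₂)) (Eq.sym vertsG))
                                  (filterᵇ-verts G G₂ (union-⊆ {G} {G₂} {G₁} (isUnion-sym {G} {G₁} {G₂} union))))
                        (cong (c ∷_) (filterᵇ-congᴬ (pre ++ post) (All.map (λ {x} → sideTwo x) others)))
                        (filterᵇ-around (V G₂) c pre post c∈G₂)

module Characterisation {r ℓ : Level} (R : CommutativeRing r ℓ) (b : Graph → CommutativeRing.Carrier R)
                        (b-resp : Poly.RespectsG R b) where
  open CommutativeRing R renaming (refl to ≈-refl; sym to ≈-sym; trans to ≈-trans) hiding (zero)
  open Poly R
  open Algebraic R
  open import Relation.Binary.Reasoning.Setoid setoid

  ConditionI : Set ℓ
  ConditionI = ∀ H → NonEmpty H → ¬ Connected H → b H ≈ 0#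

  ConditionII : Set ℓ
  ConditionII = ∀ H H₁ H₂ → IsUnion H H₁ H₂ → OneCommon H₁ H₂ → b H ≈ b H₁ * b H₂

  weight : Graph → List ℕ → Carrier
  weight G B = b (induced G B)

  weight-↭ : ∀ G → RespectsPerm (weight G)
  weight-↭ G B↭B' = b-resp _ _ (induced-↭ G B↭B')

  coeff-zero : ∀ G → NonEmpty G → coeff b G 0 ≈ 0#
  coeff-zero G nonEmpty with verts-nonEmpty G nonEmpty
  ... | v , vs , vertsG = ≈-trans (coeff≈Z b G 0)
                            (≈-trans (≡⇒≈ (cong (λ L → Z (weight G) L 0) vertsG)) (Z-∷ (weight G) v vs 0))

  coeff-one : ∀ G → NonEmpty G → coeff b G 1 ≈ b G
  coeff-one G nonEmpty with verts-nonEmpty G nonEmpty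
  ... | v , vs , vertsG = begin
      coeff b G 1                   ≈⟨ coeff≈Z b G 1 ⟩
      Z (weight G) (verts G) 1      ≡⟨ cong (λ L → Z (weight G) L 1) vertsG ⟩
      Z (weight G) (v ∷ vs) 1       ≈⟨ Z-one-block (weight G) v vs ⟩
      weight G (v ∷ vs)             ≡⟨ cong (weight G) (Eq.sym vertsG) ⟩
      b (induced G (verts G))       ≈⟨ b-resp _ _ (induced-verts G) ⟩
      b G                           ∎

  Z-side : ∀ {G G₁ G₂} → IsUnion G G₁ G₂ → AtMostOneCommon G₁ G₂ → Z (weight G) (verts G₁) ≐ coeff b G₁
  Z-side {G} {G₁} {G₂} union atMostOne k =
    ≈-trans (Z-congᵂ (λ B B⊆G₁ → b-resp _ _ (induced-side {G} {G₁} {G₂} union atMostOne B B⊆G₁)) (verts G₁) (verts-All G₁) k)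
            (≈-sym (coeff≈Z b G₁ k))

  mixedZero : ConditionI → ∀ {G G₁ G₂} → IsUnion G G₁ G₂ → ∀ {Q : ℕ → Set} →
    (∀ u → Q u → V G u ≡ true) → (∀ u → Q u → V G₁ u ≡ true → V G₂ u ≡ false) → MixedZero (V G₁) Q (weight G)
  mixedZero conditionI {G} {G₁} {G₂} union Q⊆G unshared B qB B⊈G₁ B⊈¬G₁ =
    conditionI (induced G B) (proj₁ disconnected) (proj₂ disconnected)
    where
    disconnected : NonEmpty (induced G B) × ¬ Connected (induced G B)
    disconnected = mixed-disconnected {G} {G₁} {G₂} union Q⊆G unshared B qB B⊈G₁ B⊈¬G₁

  -- (i) makes f_b multiplicative: no block of a contributing partition
  -- meets both G₁ and G₂.
  multiplicative : ConditionI → Multiplicative b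
  multiplicative conditionI G G₁ G₂ union disjoint k = begin
      coeff b G k
    ≈⟨ coeff≈Z b G k ⟩
      Z (weight G) (verts G) k
    ≈⟨ Z-multiplicative k (V G₁) mixed (verts G) (verts-All G) ⟩
      cv (Z (weight G) (filterᵇ (V G₁) (verts G))) (Z (weight G) (filterᵇ (not ∘ V G₁) (verts G))) k
    ≡⟨ cong₂ (λ L₁ L₂ → cv (Z (weight G) L₁) (Z (weight G) L₂) k)
             (filterᵇ-verts G G₁ (union-⊆ {G} {G₁} {G₂} union)) vertsG₂ ⟩
      cv (Z (weight G) (verts G₁)) (Z (weight G) (verts G₂)) k
    ≈⟨ cv-cong (Z-side {G} {G₁} {G₂} union atMostOne) (Z-side {G} {G₂} {G₁} (isUnion-sym {G} {G₁} {G₂} union) (atMostOne-sym {G₁} {G₂} atMostOne)) k ⟩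
      cv (coeff b G₁) (coeff b G₂) k
    ≈⟨ ≈-sym (conv≐cv (coeff b G₁) (coeff b G₂) k) ⟩
      conv (coeff b G₁) (coeff b G₂) k
    ∎
    where
    unshared : ∀ u → V G u ≡ true → V G₁ u ≡ true → V G₂ u ≡ false
    unshared u _ u∈G₁ with V G₂ u in u∈G₂
    ... | true  = ⊥-elim (disjoint u u∈G₁ u∈G₂)
    ... | false = refl
    atMostOne : AtMostOneCommon G₁ G₂
    atMostOne u v u∈G₁ u∈G₂ _ _ = ⊥-elim (disjoint u u∈G₁ u∈G₂)
    mixed : MixedZero (V G₁) (λ u → V G u ≡ true) (weight G)
    mixed = mixedZero conditionI {G} {G₁} {G₂} union (λ u u∈G → u∈G) unshared
    vertsG₂ : filterᵇ (not ∘ V G₁) (verts G) ≡ verts G₂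
    vertsG₂ = Eq.trans (filterᵇ-congᴬ (verts G) (All.map (λ {x} x∈G → complement-side {G} {G₁} {G₂} union x x∈G (unshared x x∈G)) (verts-All G)))
                       (filterᵇ-verts G G₂ (union-⊆ {G} {G₂} {G₁} (isUnion-sym {G} {G₁} {G₂} union)))

  -- (i) and (ii) give x · f(G) = f(G₁) f(G₂) when G₁, G₂ share one vertex c:
  -- list c first; the block of c splits by (ii), the other blocks by (i).
  gluing : ConditionI → ConditionII → ∀ G G₁ G₂ → IsUnion G G₁ G₂ → OneCommon G₁ G₂ →
           ∀ k → shift (coeff b G) k ≈ conv (coeff b G₁) (coeff b G₂) k
  gluing conditionI conditionII G G₁ G₂ union (c , c∈G₁ , c∈G₂ , onlyC) k
    with verts-common {G} {G₁} {G₂} c union c∈G₁ c∈G₂ onlyC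
  ... | vs , others , vertsG , vertsG₁ , vertsG₂ = begin
      shift (coeff b G) k
    ≈⟨ shift-cong (λ j → ≈-trans (coeff≈Z b G j) (Z-↭ (weight-↭ G) j vertsG)) k ⟩
      shift (Z (weight G) (c ∷ vs)) k
    ≈⟨ Z-gluing (V G₁) c vs others mixed glue k ⟩
      cv (Z (weight G) (c ∷ filterᵇ (V G₁) vs)) (Z (weight G) (c ∷ filterᵇ (not ∘ V G₁) vs)) k
    ≈⟨ cv-cong (λ j → ≈-sym (Z-↭ (weight-↭ G) j vertsG₁)) (λ j → ≈-sym (Z-↭ (weight-↭ G) j vertsG₂)) k ⟩
      cv (Z (weight G) (verts G₁)) (Z (weight G) (verts G₂)) k
    ≈⟨ cv-cong (Z-side {G} {G₁} {G₂} union atMostOne) (Z-side {G} {G₂} {G₁} (isUnion-sym {G} {G₁} {G₂} union) (atMostOne-sym {G₁} {G₂} atMostOne)) k ⟩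
      cv (coeff b G₁) (coeff b G₂) k
    ≈⟨ ≈-sym (conv≐cv (coeff b G₁) (coeff b G₂) k) ⟩
      conv (coeff b G₁) (coeff b G₂) k
    ∎
    where
    atMostOne : AtMostOneCommon G₁ G₂
    atMostOne u v u∈G₁ u∈G₂ v∈G₁ v∈G₂ = Eq.trans (onlyC u u∈G₁ u∈G₂) (Eq.sym (onlyC v v∈G₁ v∈G₂))
    mixed : MixedZero (V G₁) (OtherVertex G c) (weight G)
    mixed = mixedZero conditionI {G} {G₁} {G₂} union (λ u → proj₁) (λ u other → other-unshared {G₁} {G₂} onlyC u (proj₂ other))
    glue : ∀ T → All (OtherVertex G c) T →
           weight G (c ∷ T) ≈ weight G (c ∷ filterᵇ (V G₁) T) * weight G (c ∷ filterᵇ (not ∘ V G₁) T)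
    glue T _ = conditionII _ _ _ (proj₁ glued) (proj₂ glued)
      where
      glued : IsUnion (induced G (c ∷ T)) (induced G (c ∷ filterᵇ (V G₁) T)) (induced G (c ∷ filterᵇ (not ∘ V G₁) T))
            × OneCommon (induced G (c ∷ filterᵇ (V G₁) T)) (induced G (c ∷ filterᵇ (not ∘ V G₁) T))
      glued = induced-glue {G} {G₁} {G₂} c union c∈G₁ onlyC T

  -- Multiplicativity forces (i): split a non-empty disconnected H into two
  -- non-empty disjoint parts and compare the coefficients of x.
  conditionI-from : Multiplicative b → ConditionI
  conditionI-from mult H nonEmpty disconnected with disconnected-split H nonEmpty disconnected
  ... | H₁ , H₂ , union , disjoint , nonEmpty₁ , nonEmpty₂ = begin
      b H
    ≈⟨ ≈-sym (coeff-one H nonEmpty) ⟩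
      coeff b H 1
    ≈⟨ ≈-trans (mult H H₁ H₂ union disjoint 1) (conv≐cv (coeff b H₁) (coeff b H₂) 1) ⟩
      coeff b H₁ 0 * coeff b H₂ 1 + coeff b H₁ 1 * coeff b H₂ 0
    ≈⟨ +-cong (≈-trans (*-cong (coeff-zero H₁ nonEmpty₁) ≈-refl) (zeroˡ _))
              (≈-trans (*-cong ≈-refl (coeff-zero H₂ nonEmpty₂)) (zeroʳ _)) ⟩
      0# + 0#
    ≈⟨ +-identityˡ _ ⟩
      0#
    ∎

  -- The gluing identity forces (ii): compare the coefficients of x².
  conditionII-from : TwoMultiplicative b → ConditionII
  conditionII-from (_ , glue) H H₁ H₂ union common@(c , c∈H₁ , c∈H₂ , _) = begin
      b H
    ≈⟨ ≈-sym (coeff-one H (c , union-⊆ {H} {H₁} {H₂} union c c∈H₁)) ⟩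
      coeff b H 1
    ≈⟨ ≈-trans (glue H H₁ H₂ union common 2) (conv≐cv (coeff b H₁) (coeff b H₂) 2) ⟩
      coeff b H₁ 0 * coeff b H₂ 2 + (coeff b H₁ 1 * coeff b H₂ 1 + coeff b H₁ 2 * coeff b H₂ 0)
    ≈⟨ +-cong (≈-trans (*-cong (coeff-zero H₁ (c , c∈H₁)) ≈-refl) (zeroˡ _))
              (+-cong ≈-refl (≈-trans (*-cong ≈-refl (coeff-zero H₂ (c , c∈H₂))) (zeroʳ _))) ⟩
      0# + (coeff b H₁ 1 * coeff b H₂ 1 + 0#)
    ≈⟨ ≈-trans (+-identityˡ _) (+-identityʳ _) ⟩
      coeff b H₁ 1 * coeff b H₂ 1
    ≈⟨ *-cong (coeff-one H₁ (c , c∈H₁)) (coeff-one H₂ (c , c∈H₂)) ⟩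
      b H₁ * b H₂
    ∎

theorem6p5 : ∀ {c ℓ : Level} (R : CommutativeRing c ℓ) →
    let open CommutativeRing R
        open Poly R
    in (b : Graph → Carrier) → RespectsG b →
       TwoMultiplicative b ⇔
         ((∀ H → NonEmpty H → ¬ Connected H → b H ≈ 0#)
          × (∀ H H₁ H₂ → IsUnion H H₁ H₂ → OneCommon H₁ H₂ → b H ≈ b H₁ * b H₂))
theorem6p5 R b b-resp = mk⇔
  (λ twoMultiplicative → conditionI-from (proj₁ twoMultiplicative) , conditionII-from twoMultiplicative)
  (λ conditions → multiplicative (proj₁ conditions) , gluing (proj₁ conditions) (proj₂ conditions))
  where open Characterisation R b b-resp
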